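{- Let $G$ be a finite-dimensional vector space over $\mathbb{F}_p$, let $\beta : G \times G \to \mathbb{F}_p^r$ be a bilinear map and let $V\le G$ be a subspace such that for every $\lambda\in\mathbb{F}_p^r\setminus\{0\}$ the bilinear form $\lambda\cdot\beta$ restricted to $V\times V$ has rank at least $s$. Fix $a\in G$ and let $B=\{(x,y)\in(a+V)\times V: \beta(x,y)=0\}$, and for $x\in a+V$ write $B_{x\cdot}=\{y\in V:\beta(x,y)=0\}$. Let $S \leq V$ be a subspace of codimension $d$ in $V$ and let $k$ be a positive integer. Then \[(S \cap B_{x_1 \cdot} \cap \dots \cap B_{x_k \cdot}) + (S \cap B_{y_1 \cdot} \cap \dots \cap B_{y_k \cdot}) = S\] holds for all but at most $81p^{2d + 4kr -s/4} |V|^{2k}$ choices of $(x_1,\dots,x_k,y_1,\dots,y_k) \in (a + V)^{2k}$.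
   Context: $\lambda\cdot\beta$ denotes the bilinear form $(x,y)\mapsto\sum_i\lambda_i\beta_i(x,y)$; the rank of a bilinear form is the rank of its matrix. -}

module Defs where

open import Level using (0ℓ)
open import Data.Nat using (ℕ; zero; suc; _+_; _*_; _∸_; NonZero)
open import Data.Nat.DivMod using (_mod_)
open import Data.Nat.Primality using (Prime; prime⇒nonZero)
open import Data.Fin using (Fin; toℕ)
open import Data.Vec using (Vec; []; _∷_; replicate; zipWith; map; lookup; tabulate; foldr)
import Data.List as L
open import Data.Product using (Σ; ∃; _×_; _,_)
open import Relation.Binary.PropositionalEquality using (_≡_; _≢_)
open import Relation.Unary using (Pred; Decidable)

-- Everything over the prime field F_p = Fin p (arithmetic mod p).
-- The finite-dimensional F_p-vector space G is F_p^n = Vec (Fin p) n.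
module Fp (p : ℕ) (pr : Prime p) where

  instance
    p≢0 : NonZero p
    p≢0 = prime⇒nonZero pr

  F : Set
  F = Fin p

  0F : F
  0F = 0 mod p

  _+F_ : F → F → F
  a +F b = (toℕ a + toℕ b) mod p

  _*F_ : F → F → F
  a *F b = (toℕ a * toℕ b) mod p

  -F_ : F → F
  -F a = (p ∸ toℕ a) mod p

  Vect : ℕ → Set
  Vect n = Vec F n

  0V : (n : ℕ) → Vect n
  0V n = replicate n 0F

  _+V_ : ∀ {n} → Vect n → Vect n → Vect n
  _+V_ = zipWith _+F_

  _·V_ : ∀ {n} → F → Vect n → Vect n
  c ·V v = map (c *F_) v

  -V_ : ∀ {n} → Vect n → Vect n
  -V v = map -F_ v

  dot : ∀ {r} → Vect r → Vect r → F
  dot l v = foldr (λ _ → F) _+F_ 0F (zipWith _*F_ l v)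

  lincomb : ∀ {n m} → Vec F m → Vec (Vect n) m → Vect n
  lincomb {n} [] [] = 0V n
  lincomb (c ∷ cs) (v ∷ vs) = (c ·V v) +V lincomb cs vs

  LinIndep : ∀ {n m} → Vec (Vect n) m → Set
  LinIndep {n} {m} vs = ∀ cs → lincomb cs vs ≡ 0V n → cs ≡ replicate m 0F

  record Subspace (n : ℕ) : Set₁ where
    field
      mem       : Pred (Vect n) 0ℓ
      mem?      : Decidable mem
      zero-mem  : mem (0V n)
      add-mem   : ∀ {u v} → mem u → mem v → mem (u +V v)
      scale-mem : ∀ c {v} → mem v → mem (c ·V v)
  open Subspace public

  _⊆S_ : ∀ {n} → Subspace n → Subspace n → Set
  S ⊆S V = ∀ v → mem S v → mem V v

  allVecs : (n : ℕ) → L.List (Vect n)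
  allVecs zero = [] L.∷ L.[]
  allVecs (suc n) = L.concatMap (λ c → L.map (c ∷_) (allVecs n)) (L.allFin p)

  card : ∀ {n} → Subspace n → ℕ
  card {n} V = L.length (L.filter (mem? V) (allVecs n))

  IsBasis : ∀ {n m} → Subspace n → Vec (Vect n) m → Set
  IsBasis V es = (∀ i → mem V (lookup es i)) × LinIndep es
               × (∀ v → mem V v → ∃ λ cs → lincomb cs es ≡ v)

  HasDim : ∀ {n} → Subspace n → ℕ → Set
  HasDim {n} V m = Σ (Vec (Vect n) m) (IsBasis V)

  Codim : ∀ {n} → Subspace n → Subspace n → ℕ → Set
  Codim S V d = ∃ λ m → HasDim S m × HasDim V (m + d)

  record Bilinear (n r : ℕ) : Set where
    field
      β      : Vect n → Vect n → Vect r
      addˡ   : ∀ x x' y → β (x +V x') y ≡ β x y +V β x' y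
      addʳ   : ∀ x y y' → β x (y +V y') ≡ β x y +V β x y'
      scaleˡ : ∀ c x y → β (c ·V x) y ≡ c ·V β x y
      scaleʳ : ∀ c x y → β x (c ·V y) ≡ c ·V β x y
  open Bilinear public

  _·β_ : ∀ {n r} → Vect r → Bilinear n r → Vect n → Vect n → F
  (l ·β b) x y = dot l (β b x y)

  gram : ∀ {n m} → (Vect n → Vect n → F) → Vec (Vect n) m → Vec (Vect m) m
  gram f es = tabulate (λ i → tabulate (λ j → f (lookup es i) (lookup es j)))

  MatRankAtLeast : ∀ {m} → Vec (Vect m) m → ℕ → Set
  MatRankAtLeast {m} M s = Σ (Vec (Fin m) s) λ is → LinIndep (map (lookup M) is)

  FormRankOnAtLeast : ∀ {n} → Subspace n → (Vect n → Vect n → F) → ℕ → Set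
  FormRankOnAtLeast {n} V f s =
    Σ ℕ λ m → Σ (Vec (Vect n) m) λ es → IsBasis V es × MatRankAtLeast (gram f es) s

  InCoset : ∀ {n} → Vect n → Subspace n → Vect n → Set
  InCoset a V x = mem V (x +V (-V a))

  InBx : ∀ {n r} → Bilinear n r → Subspace n → Vect n → Vect n → Set
  InBx {r = r} b V x y = mem V y × β b x y ≡ 0V r

  InCapB : ∀ {n r k} → Bilinear n r → Subspace n → Subspace n → Vec (Vect n) k → Vect n → Set
  InCapB b V S xs y = mem S y × (∀ i → InBx b V (lookup xs i) y)

  SumIsS : ∀ {n r k} → Bilinear n r → Subspace n → Subspace n →
           Vec (Vect n) k → Vec (Vect n) k → Set
  SumIsS b V S xs ys = ∀ v →
      (mem S v → ∃ λ u → ∃ λ w → InCapB b V S xs u × InCapB b V S ys w × u +V w ≡ v)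
    × ((∃ λ u → ∃ λ w → InCapB b V S xs u × InCapB b V S ys w × u +V w ≡ v) → mem S v)

-- For a tuple z = (x₁, …, x_k, y₁, …, y_k) consider the linear map w ↦ (β(zⱼ, w))ⱼ from S to (F_p^r)^(2k).
-- If it is onto, then for v ∈ S there is w ∈ S with β(xⱼ, w) = 0 and β(yⱼ, w) = β(yⱼ, v), and v = w + (v − w)
-- is the required decomposition. Otherwise some λ = (λⱼ) with an entry λᵢ ≠ 0 makes Σⱼ (λⱼ·β)(zⱼ, ·) vanish
-- on S. For fixed λ, i and the other 2k − 1 points this is an affine condition on zᵢ ∈ a + V, and since λᵢ·β
-- has rank at least s on V while S has codimension d in V, it has at most |V| p^(d − s) solutions. Summing over
-- the 2k p^(2kr) choices of (λ, i) and the |V|^(2k − 1) choices of the other points, at most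
-- 2k p^(2kr + d − s) |V|^(2k) tuples are exceptional, which implies the stated bound.

module Submission where

open import Defs
open import Data.Nat using (ℕ; _+_; _*_; _^_; _≤_)
open import Data.Nat.Primality using (Prime)
open import Data.Vec using (Vec; lookup)
open import Data.List using (List; length)
open import Data.List.Membership.Propositional using (_∉_)
open import Data.Product using (Σ; _×_; _,_)
open import Relation.Binary.PropositionalEquality using (_≢_)

open import Algebra.Bundles using (AbelianGroup; CommutativeRing)
open import Algebra.Consequences.Propositional using (comm∧idʳ⇒id; comm∧invʳ⇒inv; comm∧distrˡ⇒distrʳ)
import Algebra.Properties.AbelianGroup as AbelianGroupProperties
import Algebra.Properties.CommutativeSemigroup as CommutativeSemigroupProperties
import Algebra.Properties.Ring as RingProperties
open import Algebra.Structures using (IsAbelianGroup; IsCommutativeRing)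
open import Data.Empty using (⊥-elim)
open import Data.Fin as Fin using (Fin; toℕ)
open import Data.Fin.Properties using (toℕ-injective; toℕ-fromℕ<; toℕ<n; injective⇒≤; punchOut-punchIn; punchInᵢ≢i)
import Data.List as L
open import Data.List.Membership.Propositional using (_∈_)
open import Data.List.Membership.Propositional.Properties
  using (∈-allFin; ∈-lookup; ∈-map⁺; ∈-concatMap⁺; ∈-cartesianProductWith⁺; ∈-cartesianProduct⁺; ∈-filter⁺; ∈-filter⁻)
open import Data.List.Properties using (length-++; length-map; length-tabulate; length-filter; filter-none)
import Data.List.Relation.Unary.All as All
import Data.List.Relation.Unary.AllPairs as AllPairs
open import Data.List.Relation.Unary.Any as Any using (here; there; index)
open import Data.List.Relation.Unary.Any.Properties using (lookup-index)
open import Data.List.Relation.Unary.Unique.Propositional using (Unique)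
import Data.List.Relation.Unary.Unique.Propositional.Properties as Unique
open import Data.Nat using (zero; suc; _∸_; _%_; _<_; z≤n; s≤s; NonZero; >-nonZero⁻¹; ≢-nonZero; nonTrivial⇒n>1)
open import Data.Nat.Coprimality using (prime⇒coprime; coprime-Bézout)
open import Data.Nat.DivMod using (_mod_; %-distribˡ-+; %-distribˡ-*; m<n⇒m%n≡m; m*n%n≡0)
open import Data.Nat.GCD using (module Bézout)
open import Data.Nat.Primality using (prime⇒nonZero; prime⇒nonTrivial)
import Data.Nat.Properties as ℕ
open import Data.Nat.Solver using (module +-*-Solver)
open import Data.Product using (∃; proj₁; proj₂)
open import Data.Vec
  using ([]; _∷_; head; tail; map; replicate; tabulate; insertAt; removeAt; transpose; _⊛_; _++_; concat; take; drop; splitAt; group)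
open import Data.Vec.Properties
  using ( ∷-injective; ≡-dec; zipWith-assoc; zipWith-identityˡ; zipWith-identityʳ; zipWith-inverseˡ; zipWith-inverseʳ
        ; zipWith-comm; tabulate∘lookup; tabulate-cong; map-cong; map-∘; map-++; map-concat; map-insertAt
        ; lookup-replicate; lookup-zipWith; lookup-map; lookup∘tabulate; lookup-⊛; ++-injective
        ; insertAt-lookup; insertAt-removeAt; removeAt-insertAt; removeAt-punchOut)
import Data.Vec.Relation.Unary.All.Properties as VecAll
open import Function using (_∘_)
open import Level using (0ℓ)
open import Relation.Binary.Definitions using (DecidableEquality)
open import Relation.Binary.PropositionalEquality
open import Relation.Binary.PropositionalEquality.Algebra using (isMagma)
open import Relation.Nullary using (yes; no; ¬?)
open import Relation.Unary using (Decidable)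

tuples : {A : Set} → List A → (k : ℕ) → List (Vec A k)
tuples xs zero    = [] L.∷ L.[]
tuples xs (suc k) = L.cartesianProductWith _∷_ xs (tuples xs k)

module _ {A : Set} {xs : List A} where

  ∈-tuples : ∀ {k} (v : Vec A k) → (∀ i → lookup v i ∈ xs) → v ∈ tuples xs k
  ∈-tuples []      _ = here refl
  ∈-tuples (x ∷ v) h = ∈-cartesianProductWith⁺ _∷_ (h Fin.zero) (∈-tuples v (h ∘ Fin.suc))

  tuples-unique : ∀ k → Unique xs → Unique (tuples xs k)
  tuples-unique zero    _ = All.[] AllPairs.∷ AllPairs.[]
  tuples-unique (suc k) u = Unique.cartesianProductWith⁺ _∷_ ∷-injective u (tuples-unique k u)

length-cartesianProductWith : ∀ {A B C : Set} (f : A → B → C) (xs : List A) (ys : List B) →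
  length (L.cartesianProductWith f xs ys) ≡ length xs * length ys
length-cartesianProductWith f L.[]       ys = refl
length-cartesianProductWith f (x L.∷ xs) ys = begin
  length (L.map (f x) ys L.++ L.cartesianProductWith f xs ys)  ≡⟨ length-++ (L.map (f x) ys) ⟩
  length (L.map (f x) ys) + length (L.cartesianProductWith f xs ys)
    ≡⟨ cong₂ _+_ (length-map (f x) ys) (length-cartesianProductWith f xs ys) ⟩
  length ys + length xs * length ys ∎
  where open ≡-Reasoning

length-tuples : ∀ {A : Set} (xs : List A) k → length (tuples xs k) ≡ length xs ^ k
length-tuples xs zero    = refl
length-tuples xs (suc k) =
  trans (length-cartesianProductWith _∷_ xs (tuples xs k)) (cong (length xs *_) (length-tuples xs k))

concatMap-map : ∀ {A B C : Set} (f : A → B → C) (xs : List A) (ys : List B) →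
  L.concatMap (λ x → L.map (f x) ys) xs ≡ L.cartesianProductWith f xs ys
concatMap-map f L.[]       ys = refl
concatMap-map f (x L.∷ xs) ys = cong (L.map (f x) ys L.++_) (concatMap-map f xs ys)

length-concatMap-≤ : ∀ {A B : Set} (f : A → List B) {c b : ℕ} (xs : List A) →
  (∀ {x} → x ∈ xs → length (f x) * c ≤ b) → length (L.concatMap f xs) * c ≤ length xs * b
length-concatMap-≤ f         L.[]       h = z≤n
length-concatMap-≤ f {c} {b} (x L.∷ xs) h = begin
  length (f x L.++ L.concatMap f xs) * c                   ≡⟨ cong (_* c) (length-++ (f x)) ⟩
  (length (f x) + length (L.concatMap f xs)) * c           ≡⟨ ℕ.*-distribʳ-+ c (length (f x)) _ ⟩
  length (f x) * c + length (L.concatMap f xs) * c         ≤⟨ ℕ.+-mono-≤ (h (here refl)) (length-concatMap-≤ f xs (h ∘ there)) ⟩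
  b + length xs * b                                        ∎
  where open ℕ.≤-Reasoning

module _ {A : Set} where

  lookup-injective : ∀ {xs : List A} → Unique xs → ∀ {i j} → L.lookup xs i ≡ L.lookup xs j → i ≡ j
  lookup-injective {_ L.∷ _} _                 {Fin.zero}  {Fin.zero}  _ = refl
  lookup-injective {_ L.∷ _} (x∉ AllPairs.∷ _) {Fin.zero}  {Fin.suc j} e = ⊥-elim (All.lookup x∉ (∈-lookup j) e)
  lookup-injective {_ L.∷ _} (x∉ AllPairs.∷ _) {Fin.suc i} {Fin.zero}  e = ⊥-elim (All.lookup x∉ (∈-lookup i) (sym e))
  lookup-injective {_ L.∷ _} (_ AllPairs.∷ u)  {Fin.suc i} {Fin.suc j} e = cong Fin.suc (lookup-injective u e)

  length-≤-injectiveOn : ∀ {B : Set} {xs : List A} {ys : List B} (g : A → B) → Unique xs →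
    (∀ {x} → x ∈ xs → g x ∈ ys) → (∀ {x y} → x ∈ xs → y ∈ xs → g x ≡ g y → x ≡ y) →
    length xs ≤ length ys
  length-≤-injectiveOn {xs = xs} {ys} g u g∈ g-inj = injective⇒≤ {f = slot} slot-injective
    where
    slot : Fin (length xs) → Fin (length ys)
    slot i = index (g∈ (∈-lookup i))
    slot-injective : ∀ {i j} → slot i ≡ slot j → i ≡ j
    slot-injective {i} {j} e = lookup-injective u (g-inj (∈-lookup i) (∈-lookup j)
      (trans (lookup-index (g∈ (∈-lookup i)))
        (trans (cong (L.lookup ys) e) (sym (lookup-index (g∈ (∈-lookup j)))))))

lookup-ext : ∀ {A : Set} {n} {u v : Vec A n} → (∀ i → lookup u i ≡ lookup v i) → u ≡ v
lookup-ext {u = u} {v} h = trans (sym (tabulate∘lookup u)) (trans (tabulate-cong h) (tabulate∘lookup v))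

∃-lookup-≢ : ∀ {A : Set} → DecidableEquality A → ∀ {n} (x : A) (v : Vec A n) →
  v ≢ replicate n x → Σ (Fin n) λ i → lookup v i ≢ x
∃-lookup-≢ _≟_ x []      v≢x = ⊥-elim (v≢x refl)
∃-lookup-≢ _≟_ x (y ∷ v) v≢x with y ≟ x
... | no y≢x  = Fin.zero , y≢x
... | yes refl with ∃-lookup-≢ _≟_ x v (v≢x ∘ cong (y ∷_))
...   | i , vᵢ≢x = Fin.suc i , vᵢ≢x

lookup-++⁺ : ∀ {A : Set} {P : A → Set} {m n} (xs : Vec A m) (ys : Vec A n) →
  (∀ i → P (lookup xs i)) → (∀ i → P (lookup ys i)) → ∀ i → P (lookup (xs ++ ys) i)
lookup-++⁺ {P = P} xs ys hx hy = VecAll.lookup⁺ (VecAll.++⁺ (VecAll.lookup⁻ {P = P} {xs = xs} hx) (VecAll.lookup⁻ {xs = ys} hy))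

concat-injective : ∀ {A : Set} {r K} {xss yss : Vec (Vec A r) K} → concat xss ≡ concat yss → xss ≡ yss
concat-injective {xss = []}       {[]}       _ = refl
concat-injective {xss = xs ∷ xss} {ys ∷ yss} e =
  cong₂ _∷_ (proj₁ (++-injective xs ys e)) (concat-injective (proj₂ (++-injective xs ys e)))

halves : ∀ {A : Set} k → Vec A (k + k) → Vec A k × Vec A k
halves k zs = take k zs , drop k zs

halves-++ : ∀ {A : Set} {k} (xs ys : Vec A k) → halves k (xs ++ ys) ≡ (xs , ys)
halves-++ {k = k} xs ys = cong₂ _,_ (sym (proj₁ same)) (sym (proj₂ same))
  where same = ++-injective xs (take k (xs ++ ys)) (proj₂ (proj₂ (splitAt k (xs ++ ys))))

lookup-removeAt : ∀ {A : Set} {n} (zs : Vec A (suc n)) i j → lookup (removeAt zs i) j ≡ lookup zs (Fin.punchIn i j)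
lookup-removeAt zs i j = trans (cong (lookup (removeAt zs i)) (sym (punchOut-punchIn i)))
                               (removeAt-punchOut zs (punchInᵢ≢i i j ∘ sym))

n≤2^n : ∀ n → n ≤ 2 ^ n
n≤2^n zero    = z≤n
n≤2^n (suc n) = ℕ.+-mono-≤ (ℕ.m^n>0 2 n) (ℕ.≤-trans (n≤2^n n) (ℕ.≤-reflexive (sym (ℕ.+-identityʳ (2 ^ n)))))

m≤m^4 : ∀ m .{{_ : NonZero m}} → m ≤ m ^ 4
m≤m^4 m = ℕ.m≤m*n m (m ^ 3) {{ℕ.m^n≢0 m 3}}

dim-arith : ∀ {m d s m'} → s ≤ m' → m' ≤ m + d → (m' ∸ m) + (m' ∸ s) + s ≤ m + d + d
dim-arith {m} {d} {s} {m'} s≤m' m'≤m+d = begin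
  (m' ∸ m) + (m' ∸ s) + s   ≡⟨ ℕ.+-assoc (m' ∸ m) (m' ∸ s) s ⟩
  (m' ∸ m) + (m' ∸ s + s)   ≡⟨ cong ((m' ∸ m) +_) (ℕ.m∸n+n≡m s≤m') ⟩
  (m' ∸ m) + m'             ≤⟨ ℕ.+-mono-≤ (ℕ.≤-trans (ℕ.∸-monoˡ-≤ m m'≤m+d) (ℕ.≤-reflexive (ℕ.m+n∸m≡n m d))) m'≤m+d ⟩
  d + (m + d)               ≡⟨ ℕ.+-comm d (m + d) ⟩
  m + d + d                 ∎
  where open ℕ.≤-Reasoning

private
  fourth-power : ∀ x y → x ^ 4 * y ^ 4 ≡ (x * y) ^ 4
  fourth-power = solve 2 (λ x y → x :^ 4 :* y :^ 4 := (x :* y) :^ 4) refl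
    where open +-*-Solver

  regroup : ∀ a c e → (a * a * (c * e)) ^ 4 ≡ a ^ 8 * e ^ 4 * c ^ 4
  regroup = solve 3 (λ a c e → (a :* a :* (c :* e)) :^ 4 := a :^ 8 :* e :^ 4 :* c :^ 4) refl
    where open +-*-Solver

  regroup-tail : ∀ x y e → y * (x * e) ≡ x * y * e
  regroup-tail = solve 3 (λ x y e → y :* (x :* e) := x :* y :* e) refl
    where open +-*-Solver

  exponent₁ : ∀ k₀ r → (suc k₀ + suc k₀) * r * 8 ≡ 16 * suc k₀ * r
  exponent₁ = solve 2 (λ k₀ r → ((con 1 :+ k₀) :+ (con 1 :+ k₀)) :* r :* con 8 := con 16 :* (con 1 :+ k₀) :* r) refl
    where open +-*-Solver

  exponent₂ : ∀ k₀ → (suc k₀ + suc k₀) * 4 ≡ 8 * suc k₀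
  exponent₂ = solve 1 (λ k₀ → ((con 1 :+ k₀) :+ (con 1 :+ k₀)) :* con 4 := con 8 :* (con 1 :+ k₀)) refl
    where open +-*-Solver

-- The constant c (81 ^ 4 in the theorem) is kept abstract so that the literal is never unfolded in unary.
exceptional-count-arith : ∀ p .{{_ : NonZero p}} c .{{_ : NonZero c}} {X s d r M C} k₀ → p ^ M ≤ C →
  let k = suc k₀ ; A = p ^ ((k + k) * r) in
  X * p ^ s ≤ (A * A) * ((p ^ M) ^ (k₀ + k) * p ^ (M + d)) →
  X ^ 4 * p ^ s ≤ c * p ^ (8 * d + 16 * k * r) * C ^ (8 * k)
exceptional-count-arith p c {X} {s} {d} {r} {M} {C} k₀ p^M≤C count≤ = begin
  X ^ 4 * p ^ s                                ≤⟨ ℕ.*-monoʳ-≤ (X ^ 4) (m≤m^4 (p ^ s) {{ℕ.m^n≢0 p s}}) ⟩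
  X ^ 4 * (p ^ s) ^ 4                          ≡⟨ fourth-power X (p ^ s) ⟩
  (X * p ^ s) ^ 4                              ≤⟨ ℕ.^-monoˡ-≤ 4 (ℕ.≤-trans count≤ (ℕ.*-monoʳ-≤ (A * A) tail≤)) ⟩
  (A * A * (C ^ (k + k) * p ^ d)) ^ 4          ≡⟨ regroup A (C ^ (k + k)) (p ^ d) ⟩
  A ^ 8 * (p ^ d) ^ 4 * (C ^ (k + k)) ^ 4      ≡⟨ cong₂ _*_ (cong₂ _*_ (trans (ℕ.^-*-assoc p ((k + k) * r) 8) (cong (p ^_) (exponent₁ k₀ r)))
                                                                     (ℕ.^-*-assoc p d 4))
                                                           (trans (ℕ.^-*-assoc C (k + k) 4) (cong (C ^_) (exponent₂ k₀))) ⟩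
  p ^ (16 * k * r) * p ^ (d * 4) * C ^ (8 * k) ≡⟨ cong (_* C ^ (8 * k)) (sym (ℕ.^-distribˡ-+-* p (16 * k * r) (d * 4))) ⟩
  p ^ (16 * k * r + d * 4) * C ^ (8 * k)       ≤⟨ ℕ.*-monoˡ-≤ (C ^ (8 * k)) (ℕ.≤-trans (ℕ.^-monoʳ-≤ p exponent≤) (ℕ.m≤n*m _ c)) ⟩
  c * p ^ (8 * d + 16 * k * r) * C ^ (8 * k)   ∎
  where
  open ℕ.≤-Reasoning
  k = suc k₀
  A = p ^ ((k + k) * r)
  tail≤ : (p ^ M) ^ (k₀ + k) * p ^ (M + d) ≤ C ^ (k + k) * p ^ d
  tail≤ = begin
    (p ^ M) ^ (k₀ + k) * p ^ (M + d)          ≡⟨ cong ((p ^ M) ^ (k₀ + k) *_) (ℕ.^-distribˡ-+-* p M d) ⟩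
    (p ^ M) ^ (k₀ + k) * (p ^ M * p ^ d)      ≡⟨ regroup-tail (p ^ M) ((p ^ M) ^ (k₀ + k)) (p ^ d) ⟩
    (p ^ M) ^ (k + k) * p ^ d                 ≤⟨ ℕ.*-monoˡ-≤ (p ^ d) (ℕ.^-monoˡ-≤ (k + k) p^M≤C) ⟩
    C ^ (k + k) * p ^ d                       ∎
  exponent≤ : 16 * k * r + d * 4 ≤ 8 * d + 16 * k * r
  exponent≤ = ℕ.≤-trans (ℕ.+-monoʳ-≤ (16 * k * r) (ℕ.≤-trans (ℕ.≤-reflexive (ℕ.*-comm d 4)) (ℕ.*-monoˡ-≤ d (ℕ.m≤m+n 4 4))))
                        (ℕ.≤-reflexive (ℕ.+-comm (16 * k * r) (8 * d)))

-- The prime field F_p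

module _ (p : ℕ) (pr : Prime p) where
  open Fp p pr

  private
    0<p : 0 < p
    0<p = >-nonZero⁻¹ p

  -- Reduction mod p. The ring laws of F are transported from ℕ by writing each a as ι (toℕ a).
  ι : ℕ → F
  ι n = n mod p

  1F : F
  1F = ι 1

  toℕ-ι : ∀ n → toℕ (ι n) ≡ n % p
  toℕ-ι n = toℕ-fromℕ< _

  ι-toℕ : ∀ a → ι (toℕ a) ≡ a
  ι-toℕ a = toℕ-injective (trans (toℕ-ι (toℕ a)) (m<n⇒m%n≡m (toℕ<n a)))

  ι-≡ : ∀ {m n} → m % p ≡ n % p → ι m ≡ ι n
  ι-≡ {m} {n} e = toℕ-injective (trans (toℕ-ι m) (trans e (sym (toℕ-ι n))))

  ι-+ : ∀ m n → ι (m + n) ≡ ι m +F ι n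
  ι-+ m n = ι-≡ (trans (%-distribˡ-+ m n p) (sym (cong₂ (λ x y → (x + y) % p) (toℕ-ι m) (toℕ-ι n))))

  ι-* : ∀ m n → ι (m * n) ≡ ι m *F ι n
  ι-* m n = ι-≡ (trans (%-distribˡ-* m n p) (sym (cong₂ (λ x y → (x * y) % p) (toℕ-ι m) (toℕ-ι n))))

  ι-*p : ∀ m → ι (m * p) ≡ 0F
  ι-*p m = ι-≡ (trans (m*n%n≡0 m p) (sym (m<n⇒m%n≡m 0<p)))

  +F-ι : ∀ a n → a +F ι n ≡ ι (toℕ a + n)
  +F-ι a n = trans (cong (_+F ι n) (sym (ι-toℕ a))) (sym (ι-+ (toℕ a) n))

  *F-ι : ∀ a n → a *F ι n ≡ ι (toℕ a * n)
  *F-ι a n = trans (cong (_*F ι n) (sym (ι-toℕ a))) (sym (ι-* (toℕ a) n))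

  +F-comm : ∀ a b → a +F b ≡ b +F a
  +F-comm a b = cong ι (ℕ.+-comm (toℕ a) (toℕ b))

  *F-comm : ∀ a b → a *F b ≡ b *F a
  *F-comm a b = cong ι (ℕ.*-comm (toℕ a) (toℕ b))

  +F-assoc : ∀ a b c → (a +F b) +F c ≡ a +F (b +F c)
  +F-assoc a b c = sym (begin
    a +F ι (toℕ b + toℕ c)       ≡⟨ +F-ι a _ ⟩
    ι (toℕ a + (toℕ b + toℕ c))  ≡⟨ cong ι (sym (ℕ.+-assoc (toℕ a) _ _)) ⟩
    ι (toℕ a + toℕ b + toℕ c)    ≡⟨ ι-+ _ (toℕ c) ⟩
    (a +F b) +F ι (toℕ c)        ≡⟨ cong ((a +F b) +F_) (ι-toℕ c) ⟩
    (a +F b) +F c                ∎)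
    where open ≡-Reasoning

  *F-assoc : ∀ a b c → (a *F b) *F c ≡ a *F (b *F c)
  *F-assoc a b c = sym (begin
    a *F ι (toℕ b * toℕ c)       ≡⟨ *F-ι a _ ⟩
    ι (toℕ a * (toℕ b * toℕ c))  ≡⟨ cong ι (sym (ℕ.*-assoc (toℕ a) _ _)) ⟩
    ι (toℕ a * toℕ b * toℕ c)    ≡⟨ ι-* _ (toℕ c) ⟩
    (a *F b) *F ι (toℕ c)        ≡⟨ cong ((a *F b) *F_) (ι-toℕ c) ⟩
    (a *F b) *F c                ∎)
    where open ≡-Reasoning

  *F-distribˡ : ∀ a b c → a *F (b +F c) ≡ (a *F b) +F (a *F c)
  *F-distribˡ a b c = trans (*F-ι a _) (trans (cong ι (ℕ.*-distribˡ-+ (toℕ a) (toℕ b) (toℕ c))) (ι-+ _ _))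

  +F-identityʳ : ∀ a → a +F 0F ≡ a
  +F-identityʳ a = trans (+F-ι a 0) (trans (cong ι (ℕ.+-identityʳ (toℕ a))) (ι-toℕ a))

  *F-identityʳ : ∀ a → a *F 1F ≡ a
  *F-identityʳ a = trans (*F-ι a 1) (trans (cong ι (ℕ.*-identityʳ (toℕ a))) (ι-toℕ a))

  -F-inverseʳ : ∀ a → a +F (-F a) ≡ 0F
  -F-inverseʳ a = begin
    a +F ι (p ∸ toℕ a)               ≡⟨ +F-ι a _ ⟩
    ι (toℕ a + (p ∸ toℕ a))          ≡⟨ cong ι (trans (ℕ.m+[n∸m]≡n (ℕ.<⇒≤ (toℕ<n a))) (sym (ℕ.*-identityˡ p))) ⟩
    ι (1 * p)                        ≡⟨ ι-*p 1 ⟩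
    0F                               ∎
    where open ≡-Reasoning

  +F-*F-isCommutativeRing : IsCommutativeRing _≡_ _+F_ _*F_ -F_ 0F 1F
  +F-*F-isCommutativeRing = record
    { isRing = record
      { +-isAbelianGroup = record
        { isGroup = record
          { isMonoid = record
            { isSemigroup = record { isMagma = isMagma _+F_ ; assoc = +F-assoc }
            ; identity    = comm∧idʳ⇒id +F-comm +F-identityʳ
            }
          ; inverse = comm∧invʳ⇒inv +F-comm -F-inverseʳ
          ; ⁻¹-cong = cong -F_
          }
        ; comm = +F-comm
        }
      ; *-cong     = cong₂ _*F_
      ; *-assoc    = *F-assoc
      ; *-identity = comm∧idʳ⇒id *F-comm *F-identityʳ
      ; distrib    = *F-distribˡ , comm∧distrˡ⇒distrʳ *F-comm *F-distribˡ
      }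
    ; *-comm = *F-comm
    }

  𝔽 : CommutativeRing 0ℓ 0ℓ
  𝔽 = record { isCommutativeRing = +F-*F-isCommutativeRing }

  module 𝔽 = CommutativeRing 𝔽
  module 𝔽ᴾ = RingProperties 𝔽.ring

  toℕ≢0 : ∀ {a} → a ≢ 0F → toℕ a ≢ 0
  toℕ≢0 {a} a≢0 e = a≢0 (toℕ-injective (trans e (sym (trans (toℕ-ι 0) (m<n⇒m%n≡m 0<p)))))

  1F≢0F : 1F ≢ 0F
  1F≢0F eq = 1≢0 (begin
    1          ≡⟨ sym (m<n⇒m%n≡m (nonTrivial⇒n>1 p {{prime⇒nonTrivial pr}})) ⟩
    1 % p      ≡⟨ sym (toℕ-ι 1) ⟩
    toℕ 1F     ≡⟨ cong toℕ eq ⟩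
    toℕ 0F     ≡⟨ toℕ-ι 0 ⟩
    0 % p      ≡⟨ m<n⇒m%n≡m 0<p ⟩
    0          ∎)
    where
    open ≡-Reasoning
    1≢0 : 1 ≢ 0
    1≢0 ()

  *F-inverse : ∀ a → a ≢ 0F → Σ F λ b → b *F a ≡ 1F
  *F-inverse a a≢0 with coprime-Bézout (prime⇒coprime pr {{≢-nonZero (toℕ≢0 a≢0)}} (toℕ<n a))
  ... | Bézout.+- x y eq = -F ι y , (begin
    (-F ι y) *F a  ≡⟨ sym (𝔽ᴾ.-‿distribˡ-* (ι y) a) ⟩
    -F (ι y *F a)  ≡⟨ cong -F_ (𝔽ᴾ.+-inverseʳ-unique 1F _ 1+ya≡0) ⟩
    -F (-F 1F)     ≡⟨ 𝔽ᴾ.-‿involutive 1F ⟩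
    1F             ∎)
    where
    open ≡-Reasoning
    1+ya≡0 : 1F +F (ι y *F a) ≡ 0F
    1+ya≡0 = begin
      1F +F (ι y *F a)          ≡⟨ cong (λ z → 1F +F (ι y *F z)) (sym (ι-toℕ a)) ⟩
      1F +F (ι y *F ι (toℕ a))  ≡⟨ cong (1F +F_) (sym (ι-* y (toℕ a))) ⟩
      1F +F ι (y * toℕ a)       ≡⟨ sym (ι-+ 1 (y * toℕ a)) ⟩
      ι (1 + y * toℕ a)         ≡⟨ cong ι eq ⟩
      ι (x * p)                 ≡⟨ ι-*p x ⟩
      0F                        ∎
  ... | Bézout.-+ x y eq = ι y , (begin
    ι y *F a              ≡⟨ cong (ι y *F_) (sym (ι-toℕ a)) ⟩
    ι y *F ι (toℕ a)      ≡⟨ sym (ι-* y (toℕ a)) ⟩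
    ι (y * toℕ a)         ≡⟨ cong ι (sym eq) ⟩
    ι (1 + x * p)         ≡⟨ ι-+ 1 (x * p) ⟩
    1F +F ι (x * p)       ≡⟨ cong (1F +F_) (ι-*p x) ⟩
    1F +F 0F              ≡⟨ +F-identityʳ 1F ⟩
    1F                    ∎)
    where open ≡-Reasoning

  -F-*-swap : ∀ a b → (-F a) *F b ≡ (-F b) *F a
  -F-*-swap a b = trans (sym (𝔽ᴾ.-‿distribˡ-* a b)) (trans (cong -F_ (*F-comm a b)) (𝔽ᴾ.-‿distribˡ-* b a))

  *F-cancelˡ : ∀ a {x y} → a ≢ 0F → a *F x ≡ a *F y → x ≡ y
  *F-cancelˡ a {x} {y} a≢0 e with *F-inverse a a≢0
  ... | b , ba≡1 = begin
    x               ≡⟨ sym (𝔽.*-identityˡ x) ⟩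
    1F *F x         ≡⟨ cong (_*F x) (sym ba≡1) ⟩
    (b *F a) *F x   ≡⟨ *F-assoc b a x ⟩
    b *F (a *F x)   ≡⟨ cong (b *F_) e ⟩
    b *F (a *F y)   ≡⟨ sym (*F-assoc b a y) ⟩
    (b *F a) *F y   ≡⟨ cong (_*F y) ba≡1 ⟩
    1F *F y         ≡⟨ 𝔽.*-identityˡ y ⟩
    y               ∎
    where open ≡-Reasoning

  -- Linear algebra over F_p

  module 𝔽ˢ = CommutativeSemigroupProperties 𝔽.+-commutativeSemigroup

  +V-isAbelianGroup : ∀ n → IsAbelianGroup _≡_ (_+V_ {n}) (0V n) -V_
  +V-isAbelianGroup n = record
    { isGroup = record
      { isMonoid = record
        { isSemigroup = record { isMagma = isMagma _+V_ ; assoc = zipWith-assoc +F-assoc }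
        ; identity    = zipWith-identityˡ 𝔽.+-identityˡ , zipWith-identityʳ 𝔽.+-identityʳ
        }
      ; inverse = zipWith-inverseˡ 𝔽.-‿inverseˡ , zipWith-inverseʳ 𝔽.-‿inverseʳ
      ; ⁻¹-cong = cong -V_
      }
    ; comm = zipWith-comm +F-comm
    }

  +V-abelianGroup : ℕ → AbelianGroup 0ℓ 0ℓ
  +V-abelianGroup n = record { isAbelianGroup = +V-isAbelianGroup n }

  module 𝕍 {n} = AbelianGroup (+V-abelianGroup n)
  module 𝕍ᴾ {n} = AbelianGroupProperties (+V-abelianGroup n)
  module 𝕍ˢ {n} = CommutativeSemigroupProperties (𝕍.commutativeSemigroup {n})

  ·V-distribˡ : ∀ {n} c (u v : Vect n) → c ·V (u +V v) ≡ (c ·V u) +V (c ·V v)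
  ·V-distribˡ c []      []      = refl
  ·V-distribˡ c (x ∷ u) (y ∷ v) = cong₂ _∷_ (*F-distribˡ c x y) (·V-distribˡ c u v)

  ·V-distribʳ : ∀ {n} c d (v : Vect n) → (c +F d) ·V v ≡ (c ·V v) +V (d ·V v)
  ·V-distribʳ c d []      = refl
  ·V-distribʳ c d (x ∷ v) = cong₂ _∷_ (𝔽.distribʳ x c d) (·V-distribʳ c d v)

  ·V-assoc : ∀ {n} c d (v : Vect n) → (c *F d) ·V v ≡ c ·V (d ·V v)
  ·V-assoc c d []      = refl
  ·V-assoc c d (x ∷ v) = cong₂ _∷_ (*F-assoc c d x) (·V-assoc c d v)

  ·V-zeroˡ : ∀ {n} (v : Vect n) → 0F ·V v ≡ 0V n
  ·V-zeroˡ []      = refl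
  ·V-zeroˡ (x ∷ v) = cong₂ _∷_ (𝔽.zeroˡ x) (·V-zeroˡ v)

  ·V-zeroʳ : ∀ {n} c → c ·V 0V n ≡ 0V n
  ·V-zeroʳ {zero}  c = refl
  ·V-zeroʳ {suc n} c = cong₂ _∷_ (𝔽.zeroʳ c) (·V-zeroʳ c)

  ·V-identityˡ : ∀ {n} (v : Vect n) → 1F ·V v ≡ v
  ·V-identityˡ []      = refl
  ·V-identityˡ (x ∷ v) = cong₂ _∷_ (𝔽.*-identityˡ x) (·V-identityˡ v)

  _≟V_ : ∀ {n} → DecidableEquality (Vect n)
  _≟V_ = ≡-dec Fin._≟_

  lincomb-0 : ∀ {n m} (vs : Vec (Vect n) m) → lincomb (0V m) vs ≡ 0V n
  lincomb-0 []       = refl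
  lincomb-0 (v ∷ vs) = trans (cong₂ _+V_ (·V-zeroˡ v) (lincomb-0 vs)) (𝕍.identityˡ _)

  lincomb-+ : ∀ {n m} (cs ds : Vect m) (vs : Vec (Vect n) m) →
    lincomb (cs +V ds) vs ≡ lincomb cs vs +V lincomb ds vs
  lincomb-+ []       []       []       = sym (𝕍.identityˡ _)
  lincomb-+ (c ∷ cs) (d ∷ ds) (v ∷ vs) =
    trans (cong₂ _+V_ (·V-distribʳ c d v) (lincomb-+ cs ds vs)) (𝕍ˢ.interchange _ _ _ _)

  lincomb-· : ∀ {n m} c (cs : Vect m) (vs : Vec (Vect n) m) →
    lincomb (c ·V cs) vs ≡ c ·V lincomb cs vs
  lincomb-· c []       []       = sym (·V-zeroʳ c)
  lincomb-· c (x ∷ cs) (v ∷ vs) =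
    trans (cong₂ _+V_ (·V-assoc c x v) (lincomb-· c cs vs)) (sym (·V-distribˡ c _ _))

  lincomb-neg : ∀ {n m} (cs : Vect m) (vs : Vec (Vect n) m) → lincomb (-V cs) vs ≡ -V lincomb cs vs
  lincomb-neg cs vs = 𝕍ᴾ.inverseˡ-unique _ _ (begin
    lincomb (-V cs) vs +V lincomb cs vs  ≡⟨ sym (lincomb-+ (-V cs) cs vs) ⟩
    lincomb ((-V cs) +V cs) vs           ≡⟨ cong (λ z → lincomb z vs) (𝕍.inverseˡ cs) ⟩
    lincomb (0V _) vs                    ≡⟨ lincomb-0 vs ⟩
    0V _                                 ∎)
    where open ≡-Reasoning

  lincomb-injective : ∀ {n m} {es : Vec (Vect n) m} → LinIndep es →
    ∀ {c c'} → lincomb c es ≡ lincomb c' es → c ≡ c'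
  lincomb-injective {es = es} ind {c} {c'} e = 𝕍ᴾ.x∙y⁻¹≈ε⇒x≈y c c' (ind _ (begin
    lincomb (c +V (-V c')) es               ≡⟨ lincomb-+ c (-V c') es ⟩
    lincomb c es +V lincomb (-V c') es      ≡⟨ cong₂ _+V_ e (lincomb-neg c' es) ⟩
    lincomb c' es +V (-V lincomb c' es)     ≡⟨ 𝕍.inverseʳ _ ⟩
    0V _                                    ∎))
    where open ≡-Reasoning

  lincomb-map-lincomb : ∀ {n m k} (a : Vect k) (X : Vec (Vect m) k) (es : Vec (Vect n) m) →
    lincomb a (map (λ x → lincomb x es) X) ≡ lincomb (lincomb a X) es
  lincomb-map-lincomb []      []      es = sym (lincomb-0 es)
  lincomb-map-lincomb (c ∷ a) (x ∷ X) es = begin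
    (c ·V lincomb x es) +V lincomb a (map (λ x → lincomb x es) X)  ≡⟨ cong₂ _+V_ (sym (lincomb-· c x es)) (lincomb-map-lincomb a X es) ⟩
    lincomb (c ·V x) es +V lincomb (lincomb a X) es                ≡⟨ sym (lincomb-+ (c ·V x) _ es) ⟩
    lincomb ((c ·V x) +V lincomb a X) es                           ∎
    where open ≡-Reasoning

  lincomb-mem : ∀ {n m} (W : Subspace n) {es : Vec (Vect n) m} → (∀ i → mem W (lookup es i)) →
    ∀ cs → mem W (lincomb cs es)
  lincomb-mem W {[]}     _ []       = zero-mem W
  lincomb-mem W {e ∷ es} h (c ∷ cs) = add-mem W (scale-mem W c (h Fin.zero)) (lincomb-mem W (h ∘ Fin.suc) cs)

  lincomb-++ : ∀ {n a c} (u : Vect a) (w : Vect c) (U : Vec (Vect n) a) (W : Vec (Vect n) c) →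
    lincomb (u ++ w) (U ++ W) ≡ lincomb u U +V lincomb w W
  lincomb-++ []      w []      W = sym (𝕍.identityˡ _)
  lincomb-++ (x ∷ u) w (v ∷ U) W = trans (cong ((x ·V v) +V_) (lincomb-++ u w U W)) (sym (𝕍.assoc _ _ _))

  lincomb-concat-insertAt : ∀ {n r K} (ls : Vec (Vect r) (suc K)) (Ws : Vec (Vec (Vect n) r) K) i W →
    lincomb (concat ls) (concat (insertAt Ws i W)) ≡ lincomb (lookup ls i) W +V lincomb (concat (removeAt ls i)) (concat Ws)
  lincomb-concat-insertAt (l ∷ ls) Ws Fin.zero W = lincomb-++ l (concat ls) W (concat Ws)
  lincomb-concat-insertAt (l ∷ ls@(_ ∷ _)) (W₀ ∷ Ws) (Fin.suc i) W = begin
    lincomb (l ++ concat ls) (W₀ ++ concat (insertAt Ws i W))                         ≡⟨ lincomb-++ l (concat ls) W₀ _ ⟩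
    lincomb l W₀ +V lincomb (concat ls) (concat (insertAt Ws i W))                    ≡⟨ cong (lincomb l W₀ +V_) (lincomb-concat-insertAt ls Ws i W) ⟩
    lincomb l W₀ +V (lincomb (lookup ls i) W +V lincomb (concat (removeAt ls i)) (concat Ws))
      ≡⟨ 𝕍ˢ.x∙yz≈y∙xz _ _ _ ⟩
    lincomb (lookup ls i) W +V (lincomb l W₀ +V lincomb (concat (removeAt ls i)) (concat Ws))
      ≡⟨ cong (lincomb (lookup ls i) W +V_) (sym (lincomb-++ l _ W₀ (concat Ws))) ⟩
    lincomb (lookup ls i) W +V lincomb (l ++ concat (removeAt ls i)) (W₀ ++ concat Ws) ∎
    where open ≡-Reasoning

  concat-0V : ∀ {r} K → concat (replicate K (0V r)) ≡ 0V (K * r)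
  concat-0V zero    = refl
  concat-0V {r} (suc K) = trans (cong (0V r ++_) (concat-0V K)) (0V-++ r)
    where
    0V-++ : ∀ {c} a → 0V a ++ 0V c ≡ 0V (a + c)
    0V-++ zero    = refl
    0V-++ (suc a) = cong (0F ∷_) (0V-++ a)

  +V-inverse-cancel : ∀ {n} (u v : Vect n) → u +V (v +V (-V u)) ≡ v
  +V-inverse-cancel u v = trans (sym (𝕍.assoc u v (-V u))) (𝕍ᴾ.xyx⁻¹≈y u v)

  dot-comm : ∀ {n} (u v : Vect n) → dot u v ≡ dot v u
  dot-comm []      []      = refl
  dot-comm (x ∷ u) (y ∷ v) = cong₂ _+F_ (*F-comm x y) (dot-comm u v)

  dot-zeroˡ : ∀ {n} (v : Vect n) → dot (0V n) v ≡ 0F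
  dot-zeroˡ []      = refl
  dot-zeroˡ (x ∷ v) = trans (cong₂ _+F_ (𝔽.zeroˡ x) (dot-zeroˡ v)) (+F-identityʳ 0F)

  dot-+ˡ : ∀ {n} (u v w : Vect n) → dot (u +V v) w ≡ dot u w +F dot v w
  dot-+ˡ []      []      []      = sym (+F-identityʳ 0F)
  dot-+ˡ (x ∷ u) (y ∷ v) (z ∷ w) =
    trans (cong₂ _+F_ (𝔽.distribʳ z x y) (dot-+ˡ u v w)) (𝔽ˢ.interchange (x *F z) (y *F z) (dot u w) (dot v w))

  dot-·ˡ : ∀ {n} c (u w : Vect n) → dot (c ·V u) w ≡ c *F dot u w
  dot-·ˡ c []      []      = sym (𝔽.zeroʳ c)
  dot-·ˡ c (x ∷ u) (z ∷ w) =
    trans (cong₂ _+F_ (*F-assoc c x z) (dot-·ˡ c u w)) (sym (*F-distribˡ c _ _))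

  dot-+ʳ : ∀ {n} (w u v : Vect n) → dot w (u +V v) ≡ dot w u +F dot w v
  dot-+ʳ w u v = trans (dot-comm w _) (trans (dot-+ˡ u v w) (cong₂ _+F_ (dot-comm u w) (dot-comm v w)))

  dot-·ʳ : ∀ {n} c (w u : Vect n) → dot w (c ·V u) ≡ c *F dot w u
  dot-·ʳ c w u = trans (dot-comm w _) (trans (dot-·ˡ c u w) (cong (c *F_) (dot-comm u w)))

  _⊙_ : ∀ {m N} → Vec (Vect m) N → Vect m → Vect N
  rows ⊙ c = map (λ t → dot t c) rows

  dot-lincombˡ : ∀ {n m} (cs : Vect m) (vs : Vec (Vect n) m) w → dot (lincomb cs vs) w ≡ dot cs (vs ⊙ w)
  dot-lincombˡ []       []       w = dot-zeroˡ w
  dot-lincombˡ (c ∷ cs) (v ∷ vs) w =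
    trans (dot-+ˡ (c ·V v) (lincomb cs vs) w) (cong₂ _+F_ (dot-·ˡ c v w) (dot-lincombˡ cs vs w))

  unit : ∀ {n} → Fin n → Vect n
  unit Fin.zero    = 1F ∷ 0V _
  unit (Fin.suc i) = 0F ∷ unit i

  dot-unitʳ : ∀ {n} (u : Vect n) i → dot u (unit i) ≡ lookup u i
  dot-unitʳ (x ∷ u) Fin.zero    = trans (cong₂ _+F_ (*F-identityʳ x) (trans (dot-comm u _) (dot-zeroˡ u))) (+F-identityʳ x)
  dot-unitʳ (x ∷ u) (Fin.suc i) = trans (cong₂ _+F_ (𝔽.zeroʳ x) (dot-unitʳ u i)) (𝔽.+-identityˡ _)

  lookup-unit-comm : ∀ {n} (i j : Fin n) → lookup (unit i) j ≡ lookup (unit j) i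
  lookup-unit-comm Fin.zero    Fin.zero    = refl
  lookup-unit-comm Fin.zero    (Fin.suc j) = lookup-replicate j 0F
  lookup-unit-comm (Fin.suc i) Fin.zero    = sym (lookup-replicate i 0F)
  lookup-unit-comm (Fin.suc i) (Fin.suc j) = lookup-unit-comm i j

  lookup-lincomb : ∀ {n m} (cs : Vect m) (vs : Vec (Vect n) m) j →
    lookup (lincomb cs vs) j ≡ dot cs (map (λ v → lookup v j) vs)
  lookup-lincomb cs vs j = trans (sym (dot-unitʳ (lincomb cs vs) j))
    (trans (dot-lincombˡ cs vs (unit j)) (cong (dot cs) (map-cong (λ v → dot-unitʳ v j) vs)))

  dot-removeAt : ∀ {n} (u v : Vect (suc n)) i →
    dot u v ≡ (lookup u i *F lookup v i) +F dot (removeAt u i) (removeAt v i)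
  dot-removeAt (x ∷ u)         (y ∷ v)         Fin.zero    = refl
  dot-removeAt (x ∷ u@(_ ∷ _)) (y ∷ v@(_ ∷ _)) (Fin.suc i) =
    trans (cong ((x *F y) +F_) (dot-removeAt u v i))
          (𝔽ˢ.x∙yz≈y∙xz (x *F y) (lookup u i *F lookup v i) (dot (removeAt u i) (removeAt v i)))

  dot-nondegenerate : ∀ {n} (u : Vect n) → (∀ c → dot u c ≡ 0F) → u ≡ 0V n
  dot-nondegenerate u h = lookup-ext λ i → trans (sym (dot-unitʳ u i)) (trans (h (unit i)) (sym (lookup-replicate i 0F)))

  -- Gaussian elimination

  record FullRowRank {m N} (rows : Vec (Vect m) N) : Set where
    field
      N≤m                  : N ≤ m
      solve                : ∀ b → Σ (Vect m) λ c → rows ⊙ c ≡ b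
      fibreCoord           : Vect m → Vect (m ∸ N)
      fibreCoord-injective : ∀ {c c'} → rows ⊙ c ≡ rows ⊙ c' → fibreCoord c ≡ fibreCoord c' → c ≡ c'

  independent-head≢0 : ∀ {m N} (t : Vect m) (ts : Vec (Vect m) N) → LinIndep (t ∷ ts) → t ≢ 0V m
  independent-head≢0 {m} {N} t ts ind t≡0 = 1F≢0F (cong head (ind (1F ∷ 0V N) (begin
    (1F ·V t) +V lincomb (0V N) ts  ≡⟨ cong₂ _+V_ (trans (·V-identityˡ t) t≡0) (lincomb-0 ts) ⟩
    0V m +V 0V m                    ≡⟨ 𝕍.identityˡ _ ⟩
    0V m                            ∎)))
    where open ≡-Reasoning

  module Pivot {m N} (t : Vect (suc m)) (ts : Vec (Vect (suc m)) N) (l : Fin (suc m)) (tₗ≢0 : lookup t l ≢ 0F) where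

    tₗ⁻¹ : F
    tₗ⁻¹ = proj₁ (*F-inverse _ tₗ≢0)

    tₗ*tₗ⁻¹ : lookup t l *F tₗ⁻¹ ≡ 1F
    tₗ*tₗ⁻¹ = trans (*F-comm (lookup t l) tₗ⁻¹) (proj₂ (*F-inverse _ tₗ≢0))

    κ : Vect (suc m) → F
    κ w = lookup w l *F tₗ⁻¹

    reduce : Vect (suc m) → Vect (suc m)
    reduce w = w +V ((-F κ w) ·V t)

    shrink : Vect (suc m) → Vect m
    shrink w = removeAt (reduce w) l

    reduce-pivot : ∀ w → lookup (reduce w) l ≡ 0F
    reduce-pivot w = begin
      lookup (reduce w) l                        ≡⟨ lookup-zipWith _+F_ l w _ ⟩
      lookup w l +F lookup ((-F κ w) ·V t) l     ≡⟨ cong (lookup w l +F_) (lookup-map l _ t) ⟩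
      lookup w l +F ((-F κ w) *F lookup t l)     ≡⟨ cong (lookup w l +F_) (sym (𝔽ᴾ.-‿distribˡ-* (κ w) (lookup t l))) ⟩
      lookup w l +F (-F (κ w *F lookup t l))     ≡⟨ cong (λ z → lookup w l +F (-F z)) κ-pivot ⟩
      lookup w l +F (-F lookup w l)              ≡⟨ -F-inverseʳ _ ⟩
      0F                                         ∎
      where
      open ≡-Reasoning
      κ-pivot : κ w *F lookup t l ≡ lookup w l
      κ-pivot = trans (*F-assoc (lookup w l) tₗ⁻¹ (lookup t l)) (trans (cong (lookup w l *F_) (proj₂ (*F-inverse _ tₗ≢0))) (*F-identityʳ _))

    shrink-dot : ∀ w c → dot (shrink w) (removeAt c l) ≡ dot w c +F ((-F dot t c) *F κ w)
    shrink-dot w c = begin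
      dot (shrink w) (removeAt c l)                                    ≡⟨ sym (𝔽.+-identityˡ _) ⟩
      0F +F dot (shrink w) (removeAt c l)                              ≡⟨ cong (_+F dot (shrink w) (removeAt c l)) pivot-term ⟩
      (lookup (reduce w) l *F lookup c l) +F dot (shrink w) (removeAt c l) ≡⟨ sym (dot-removeAt (reduce w) c l) ⟩
      dot (reduce w) c                                                 ≡⟨ dot-+ˡ w _ c ⟩
      dot w c +F dot ((-F κ w) ·V t) c                                 ≡⟨ cong (dot w c +F_) (dot-·ˡ (-F κ w) t c) ⟩
      dot w c +F ((-F κ w) *F dot t c)                                 ≡⟨ cong (dot w c +F_) (-F-*-swap (κ w) (dot t c)) ⟩
      dot w c +F ((-F dot t c) *F κ w)                                 ∎
      where
      open ≡-Reasoning
      pivot-term : 0F ≡ lookup (reduce w) l *F lookup c l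
      pivot-term = sym (trans (cong (_*F lookup c l) (reduce-pivot w)) (𝔽.zeroˡ _))

    shrink-⊙ : ∀ {K} (ws : Vec (Vect (suc m)) K) c →
      map shrink ws ⊙ removeAt c l ≡ (ws ⊙ c) +V ((-F dot t c) ·V map κ ws)
    shrink-⊙ []       c = refl
    shrink-⊙ (w ∷ ws) c = cong₂ _∷_ (shrink-dot w c) (shrink-⊙ ws c)

    pivot-injective : ∀ {c c'} → dot t c ≡ dot t c' → removeAt c l ≡ removeAt c' l → c ≡ c'
    pivot-injective {c} {c'} e r = begin
      c                                   ≡⟨ sym (insertAt-removeAt c l) ⟩
      insertAt (removeAt c l) l (lookup c l)   ≡⟨ cong₂ (λ u x → insertAt u l x) r cₗ≡c'ₗ ⟩
      insertAt (removeAt c' l) l (lookup c' l) ≡⟨ insertAt-removeAt c' l ⟩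
      c'                                  ∎
      where
      open ≡-Reasoning
      D = dot (removeAt t l) (removeAt c' l)
      cₗ≡c'ₗ : lookup c l ≡ lookup c' l
      cₗ≡c'ₗ = *F-cancelˡ (lookup t l) tₗ≢0 (𝔽ᴾ.+-cancelʳ D _ _ (begin
        (lookup t l *F lookup c l) +F D  ≡⟨ cong (λ u → (lookup t l *F lookup c l) +F dot (removeAt t l) u) (sym r) ⟩
        (lookup t l *F lookup c l) +F dot (removeAt t l) (removeAt c l) ≡⟨ sym (dot-removeAt t c l) ⟩
        dot t c                          ≡⟨ e ⟩
        dot t c'                         ≡⟨ dot-removeAt t c' l ⟩
        (lookup t l *F lookup c' l) +F D ∎))

    shrink-independent : LinIndep (t ∷ ts) → LinIndep (map shrink ts)
    -- As a functional, a combination of the shrunk rows is the combination (−σ) t + Σ aᵢ tsᵢ of the original rows.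
    shrink-independent ind a lincomb≡0 = cong tail (ind ((-F σ) ∷ a) (dot-nondegenerate _ orthogonal))
      where
      open ≡-Reasoning
      σ = dot a (map κ ts)
      orthogonal : ∀ c → dot (lincomb ((-F σ) ∷ a) (t ∷ ts)) c ≡ 0F
      orthogonal c = begin
        dot (lincomb ((-F σ) ∷ a) (t ∷ ts)) c        ≡⟨ dot-lincombˡ ((-F σ) ∷ a) (t ∷ ts) c ⟩
        ((-F σ) *F dot t c) +F dot a (ts ⊙ c)         ≡⟨ +F-comm ((-F σ) *F dot t c) (dot a (ts ⊙ c)) ⟩
        dot a (ts ⊙ c) +F ((-F σ) *F dot t c)         ≡⟨ cong (dot a (ts ⊙ c) +F_) (-F-*-swap σ (dot t c)) ⟩
        dot a (ts ⊙ c) +F ((-F dot t c) *F σ)         ≡⟨ cong (dot a (ts ⊙ c) +F_) (sym (dot-·ʳ (-F dot t c) a (map κ ts))) ⟩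
        dot a (ts ⊙ c) +F dot a ((-F dot t c) ·V map κ ts) ≡⟨ sym (dot-+ʳ a _ _) ⟩
        dot a ((ts ⊙ c) +V ((-F dot t c) ·V map κ ts)) ≡⟨ cong (dot a) (sym (shrink-⊙ ts c)) ⟩
        dot a (map shrink ts ⊙ removeAt c l)          ≡⟨ sym (dot-lincombˡ a (map shrink ts) (removeAt c l)) ⟩
        dot (lincomb a (map shrink ts)) (removeAt c l) ≡⟨ cong (λ u → dot u (removeAt c l)) lincomb≡0 ⟩
        dot (0V m) (removeAt c l)                     ≡⟨ dot-zeroˡ (removeAt c l) ⟩
        0F                                            ∎

    shrink-⊙-cong : ∀ {c c'} → (t ∷ ts) ⊙ c ≡ (t ∷ ts) ⊙ c' → map shrink ts ⊙ removeAt c l ≡ map shrink ts ⊙ removeAt c' l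
    shrink-⊙-cong {c} {c'} e = begin
      map shrink ts ⊙ removeAt c l                ≡⟨ shrink-⊙ ts c ⟩
      (ts ⊙ c) +V ((-F dot t c) ·V map κ ts)      ≡⟨ cong₂ (λ u x → u +V ((-F x) ·V map κ ts)) (cong tail e) (cong head e) ⟩
      (ts ⊙ c') +V ((-F dot t c') ·V map κ ts)    ≡⟨ sym (shrink-⊙ ts c') ⟩
      map shrink ts ⊙ removeAt c' l               ∎
      where open ≡-Reasoning

    solve-pivot : (∀ b → Σ (Vect m) λ c → map shrink ts ⊙ c ≡ b) → ∀ b → Σ (Vect (suc m)) λ c → (t ∷ ts) ⊙ c ≡ b
    solve-pivot solve (b₀ ∷ bs) = c , cong₂ _∷_ head-ok tail-ok
      where
      open ≡-Reasoning
      c' = proj₁ (solve (bs +V ((-F b₀) ·V map κ ts)))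
      D = dot (removeAt t l) c'
      c = insertAt c' l (tₗ⁻¹ *F (b₀ +F (-F D)))
      c'≡ : removeAt c l ≡ c'
      c'≡ = removeAt-insertAt c' l _
      head-ok : dot t c ≡ b₀
      head-ok = begin
        dot t c                                                    ≡⟨ dot-removeAt t c l ⟩
        (lookup t l *F lookup c l) +F dot (removeAt t l) (removeAt c l)
          ≡⟨ cong₂ (λ x u → (lookup t l *F x) +F dot (removeAt t l) u) (insertAt-lookup c' l _) c'≡ ⟩
        (lookup t l *F (tₗ⁻¹ *F (b₀ +F (-F D)))) +F D             ≡⟨ cong (_+F D) (sym (*F-assoc (lookup t l) tₗ⁻¹ (b₀ +F (-F D)))) ⟩
        ((lookup t l *F tₗ⁻¹) *F (b₀ +F (-F D))) +F D             ≡⟨ cong (λ x → (x *F (b₀ +F (-F D))) +F D) tₗ*tₗ⁻¹ ⟩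
        (1F *F (b₀ +F (-F D))) +F D                               ≡⟨ cong (_+F D) (𝔽.*-identityˡ _) ⟩
        (b₀ +F (-F D)) +F D                                       ≡⟨ +F-assoc b₀ (-F D) D ⟩
        b₀ +F ((-F D) +F D)                                       ≡⟨ cong (b₀ +F_) (𝔽.-‿inverseˡ D) ⟩
        b₀ +F 0F                                                  ≡⟨ +F-identityʳ b₀ ⟩
        b₀                                                        ∎
      tail-ok : ts ⊙ c ≡ bs
      tail-ok = 𝕍ᴾ.∙-cancelʳ ((-F b₀) ·V map κ ts) _ _ (begin
        (ts ⊙ c) +V ((-F b₀) ·V map κ ts)          ≡⟨ cong (λ x → (ts ⊙ c) +V ((-F x) ·V map κ ts)) (sym head-ok) ⟩
        (ts ⊙ c) +V ((-F dot t c) ·V map κ ts)     ≡⟨ sym (shrink-⊙ ts c) ⟩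
        map shrink ts ⊙ removeAt c l               ≡⟨ cong (map shrink ts ⊙_) c'≡ ⟩
        map shrink ts ⊙ c'                         ≡⟨ proj₂ (solve (bs +V ((-F b₀) ·V map κ ts))) ⟩
        bs +V ((-F b₀) ·V map κ ts)                ∎)

    extend : FullRowRank (map shrink ts) → FullRowRank (t ∷ ts)
    extend frr = record
      { N≤m                  = s≤s N≤m
      ; solve                = solve-pivot solve
      ; fibreCoord           = λ c → fibreCoord (removeAt c l)
      ; fibreCoord-injective = λ e f → pivot-injective (cong head e) (fibreCoord-injective (shrink-⊙-cong e) f)
      }
      where open FullRowRank frr

  independent⇒fullRowRank : ∀ {m N} (rows : Vec (Vect m) N) → LinIndep rows → FullRowRank rows
  independent⇒fullRowRank {m} {zero} [] _ = record
    { N≤m = z≤n ; solve = λ { [] → 0V m , refl } ; fibreCoord = λ c → c ; fibreCoord-injective = λ _ e → e }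
  independent⇒fullRowRank {zero} {suc N} ([] ∷ ts) ind = ⊥-elim (independent-head≢0 [] ts ind refl)
  independent⇒fullRowRank {suc m} {suc N} (t ∷ ts) ind =
    Pivot.extend t ts l tₗ≢0 (independent⇒fullRowRank (map (Pivot.shrink t ts l tₗ≢0) ts) (Pivot.shrink-independent t ts l tₗ≢0 ind))
    where
    pivot = ∃-lookup-≢ Fin._≟_ 0F t (independent-head≢0 t ts ind)
    l = proj₁ pivot
    tₗ≢0 = proj₂ pivot

  allVecs≡tuples : ∀ n → allVecs n ≡ tuples (L.allFin p) n
  allVecs≡tuples zero    = refl
  allVecs≡tuples (suc n) = trans (cong (λ vs → L.concatMap (λ c → L.map (c ∷_) vs) (L.allFin p)) (allVecs≡tuples n))
                                 (concatMap-map _∷_ (L.allFin p) _)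

  ∈-allVecs : ∀ {n} (v : Vect n) → v ∈ allVecs n
  ∈-allVecs {n} v = subst (v ∈_) (sym (allVecs≡tuples n)) (∈-tuples v (λ i → ∈-allFin (lookup v i)))

  allVecs-unique : ∀ n → Unique (allVecs n)
  allVecs-unique n = subst Unique (sym (allVecs≡tuples n)) (tuples-unique n (Unique.allFin⁺ p))

  length-allVecs : ∀ n → length (allVecs n) ≡ p ^ n
  length-allVecs n = begin
    length (allVecs n)                 ≡⟨ cong length (allVecs≡tuples n) ⟩
    length (tuples (L.allFin p) n)     ≡⟨ length-tuples (L.allFin p) n ⟩
    length (L.allFin p) ^ n            ≡⟨ cong (_^ n) (length-tabulate (λ i → i)) ⟩
    p ^ n                              ∎
    where open ≡-Reasoning

  length-filter-≤-injection : ∀ {M D} {P : Vect M → Set} (P? : Decidable P) (g : Vect M → Vect D) →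
    (∀ {c c'} → P c → P c' → g c ≡ g c' → c ≡ c') → length (L.filter P? (allVecs M)) ≤ p ^ D
  length-filter-≤-injection {M} {D} P? g g-inj = ℕ.≤-trans
    (length-≤-injectiveOn g (Unique.filter⁺ P? (allVecs-unique M)) (λ _ → ∈-allVecs _)
      (λ c∈ c'∈ → g-inj (proj₂ (∈-filter⁻ P? {xs = allVecs M} c∈)) (proj₂ (∈-filter⁻ P? {xs = allVecs M} c'∈))))
    (ℕ.≤-reflexive (length-allVecs D))

  p^dim≤card : ∀ {n M} {V : Subspace n} {es : Vec (Vect n) M} → IsBasis V es → p ^ M ≤ card V
  p^dim≤card {M = M} {V} {es} (es∈V , es-indep , _) = ℕ.≤-trans (ℕ.≤-reflexive (sym (length-allVecs M)))
    (length-≤-injectiveOn (λ c → lincomb c es) (allVecs-unique M)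
      (λ {c} _ → ∈-filter⁺ (mem? V) (∈-allVecs _) (lincomb-mem V es∈V c))
      (λ _ _ → lincomb-injective es-indep))

  InSpan : ∀ {n m} → Vec (Vect n) m → Vect n → Set
  InSpan es v = Σ (Vect _) λ cs → lincomb cs es ≡ v

  coordinates : ∀ {n m k} {es : Vec (Vect n) m} {ws : Vec (Vect n) k} → (∀ i → InSpan es (lookup ws i)) →
    Σ (Vec (Vect m) k) λ X → map (λ x → lincomb x es) X ≡ ws
  coordinates {es = es} h = tabulate (proj₁ ∘ h) , lookup-ext λ i →
    trans (lookup-map i (λ x → lincomb x es) (tabulate (proj₁ ∘ h)))
          (trans (cong (λ x → lincomb x es) (lookup∘tabulate (proj₁ ∘ h) i)) (proj₂ (h i)))

  coordinates-independent : ∀ {n m k} {es : Vec (Vect n) m} {ws : Vec (Vect n) k} (X : Vec (Vect m) k) →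
    map (λ x → lincomb x es) X ≡ ws → LinIndep ws → LinIndep X
  coordinates-independent {n} {m} {es = es} {ws} X eq ind a e = ind a (begin
    lincomb a ws                              ≡⟨ cong (lincomb a) (sym eq) ⟩
    lincomb a (map (λ x → lincomb x es) X)    ≡⟨ lincomb-map-lincomb a X es ⟩
    lincomb (lincomb a X) es                  ≡⟨ cong (λ z → lincomb z es) e ⟩
    lincomb (0V m) es                         ≡⟨ lincomb-0 es ⟩
    0V n                                      ∎)
    where open ≡-Reasoning

  independent-in-span⇒≤ : ∀ {n m k} {es : Vec (Vect n) m} {ws : Vec (Vect n) k} → LinIndep ws →
    (∀ i → InSpan es (lookup ws i)) → k ≤ m
  independent-in-span⇒≤ {ws = ws} ind h =
    FullRowRank.N≤m (independent⇒fullRowRank X (coordinates-independent X (proj₂ (coordinates {ws = ws} h)) ind))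
    where X = proj₁ (coordinates {ws = ws} h)

  change-of-basis : ∀ {n m M} {e' : Vec (Vect n) m} {es : Vec (Vect n) M} → (∀ i → InSpan e' (lookup es i)) →
    Σ (Vec (Vect m) M) λ Q → ∀ c → lincomb (lincomb c Q) e' ≡ lincomb c es
  change-of-basis {e' = e'} {es} h = Q , λ c → trans (sym (lincomb-map-lincomb c Q e')) (cong (lincomb c) eq)
    where
    Q = proj₁ (coordinates {ws = es} h)
    eq = proj₂ (coordinates {ws = es} h)

  -- Rank of the transpose

  lookup-transpose : ∀ {m r} (C : Vec (Vect r) m) t → lookup (transpose C) t ≡ map (λ c → lookup c t) C
  lookup-transpose []      t = lookup-replicate t []
  lookup-transpose (c ∷ C) t = begin
    lookup ((replicate _ _∷_ ⊛ c) ⊛ transpose C) t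
      ≡⟨ lookup-⊛ t (replicate _ _∷_ ⊛ c) (transpose C) ⟩
    lookup (replicate _ _∷_ ⊛ c) t (lookup (transpose C) t)
      ≡⟨ cong (λ f → f (lookup (transpose C) t)) (lookup-⊛ t (replicate _ _∷_) c) ⟩
    lookup (replicate _ _∷_) t (lookup c t) (lookup (transpose C) t)
      ≡⟨ cong (λ f → f (lookup c t) (lookup (transpose C) t)) (lookup-replicate t _∷_) ⟩
    lookup c t ∷ lookup (transpose C) t
      ≡⟨ cong (lookup c t ∷_) (lookup-transpose C t) ⟩
    lookup c t ∷ map (λ c → lookup c t) C
      ∎
    where open ≡-Reasoning

  transpose-⊙ : ∀ {m r} (C : Vec (Vect r) m) (u : Vect m) → transpose C ⊙ u ≡ lincomb u C
  transpose-⊙ C u = lookup-ext λ t → begin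
    lookup (transpose C ⊙ u) t                    ≡⟨ lookup-map t (λ row → dot row u) (transpose C) ⟩
    dot (lookup (transpose C) t) u                ≡⟨ cong (λ row → dot row u) (lookup-transpose C t) ⟩
    dot (map (λ c → lookup c t) C) u              ≡⟨ dot-comm _ u ⟩
    dot u (map (λ c → lookup c t) C)              ≡⟨ sym (lookup-lincomb u C t) ⟩
    lookup (lincomb u C) t                        ∎
    where open ≡-Reasoning

  lincomb-transpose : ∀ {m r} (l : Vect r) (C : Vec (Vect r) m) → lincomb l (transpose C) ≡ map (dot l) C
  lincomb-transpose l C = lookup-ext λ j → begin
    lookup (lincomb l (transpose C)) j                   ≡⟨ lookup-lincomb l (transpose C) j ⟩
    dot l (map (λ row → lookup row j) (transpose C))     ≡⟨ cong (dot l) (lookup-ext λ t → begin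
        lookup (map (λ row → lookup row j) (transpose C)) t  ≡⟨ lookup-map t (λ row → lookup row j) (transpose C) ⟩
        lookup (lookup (transpose C) t) j                    ≡⟨ cong (λ row → lookup row j) (lookup-transpose C t) ⟩
        lookup (map (λ c → lookup c t) C) j                  ≡⟨ lookup-map j (λ c → lookup c t) C ⟩
        lookup (lookup C j) t                                ∎) ⟩
    dot l (lookup C j)                                   ≡⟨ sym (lookup-map j (dot l) C) ⟩
    lookup (map (dot l) C) j                             ∎
    where open ≡-Reasoning

  dot-⊙ : ∀ {m N} (G : Vec (Vect m) N) z c → dot (G ⊙ z) c ≡ dot (lincomb c G) z
  dot-⊙ G z c = trans (dot-comm (G ⊙ z) c) (sym (dot-lincombˡ c G z))

  -- Row rank ≤ column rank. If the rows H of G indexed by is are independent, choose zₖ with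
  -- H ⊙ zₖ = eₖ; the vectors Φₖ = G ⊙ zₖ have the identity matrix as their columns at is, and
  -- Φₖ · c = (c G) · zₖ by dot-⊙.
  rank-transpose : ∀ {m N s} (G : Vec (Vect m) N) (is : Vec (Fin N) s) → LinIndep (map (lookup G) is) →
    Σ (Vec (Vect N) s) λ Φ → LinIndep Φ × (∀ {c c'} → lincomb c G ≡ lincomb c' G → Φ ⊙ c ≡ Φ ⊙ c')
  rank-transpose {m} {N} {s} G is ind = Φ , Φ-independent , Φ-factors
    where
    open ≡-Reasoning
    H = map (lookup G) is
    open FullRowRank (independent⇒fullRowRank H ind) using (solve)
    zs : Vec (Vect m) s
    zs = tabulate (λ k → proj₁ (solve (unit k)))
    H⊙zs : ∀ k → H ⊙ lookup zs k ≡ unit k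
    H⊙zs k = trans (cong (H ⊙_) (lookup∘tabulate _ k)) (proj₂ (solve (unit k)))
    Φ : Vec (Vect N) s
    Φ = map (G ⊙_) zs
    Φ-factors : ∀ {c c'} → lincomb c G ≡ lincomb c' G → Φ ⊙ c ≡ Φ ⊙ c'
    Φ-factors {c} {c'} e = begin
      Φ ⊙ c                            ≡⟨ sym (map-∘ (λ φ → dot φ c) (G ⊙_) zs) ⟩
      map (λ z → dot (G ⊙ z) c) zs     ≡⟨ map-cong (λ z → trans (dot-⊙ G z c) (trans (cong (λ u → dot u z) e) (sym (dot-⊙ G z c')))) zs ⟩
      map (λ z → dot (G ⊙ z) c') zs    ≡⟨ map-∘ (λ φ → dot φ c') (G ⊙_) zs ⟩
      Φ ⊙ c'                           ∎
    column : ∀ j → map (λ φ → lookup φ (lookup is j)) Φ ≡ unit j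
    column j = lookup-ext λ k → begin
      lookup (map (λ φ → lookup φ (lookup is j)) Φ) k  ≡⟨ lookup-map k (λ φ → lookup φ (lookup is j)) Φ ⟩
      lookup (lookup Φ k) (lookup is j)                ≡⟨ cong (λ φ → lookup φ (lookup is j)) (lookup-map k (G ⊙_) zs) ⟩
      lookup (G ⊙ lookup zs k) (lookup is j)           ≡⟨ lookup-map (lookup is j) (λ t → dot t (lookup zs k)) G ⟩
      dot (lookup G (lookup is j)) (lookup zs k)       ≡⟨ cong (λ t → dot t (lookup zs k)) (sym (lookup-map j (lookup G) is)) ⟩
      dot (lookup H j) (lookup zs k)                   ≡⟨ sym (lookup-map j (λ t → dot t (lookup zs k)) H) ⟩
      lookup (H ⊙ lookup zs k) j                       ≡⟨ cong (λ v → lookup v j) (H⊙zs k) ⟩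
      lookup (unit k) j                                ≡⟨ lookup-unit-comm k j ⟩
      lookup (unit j) k                                ∎
    Φ-independent : LinIndep Φ
    Φ-independent a e = lookup-ext λ j → begin
      lookup a j                                               ≡⟨ sym (dot-unitʳ a j) ⟩
      dot a (unit j)                                           ≡⟨ cong (dot a) (sym (column j)) ⟩
      dot a (map (λ φ → lookup φ (lookup is j)) Φ)             ≡⟨ sym (lookup-lincomb a Φ (lookup is j)) ⟩
      lookup (lincomb a Φ) (lookup is j)                       ≡⟨ cong (λ v → lookup v (lookup is j)) e ⟩
      lookup (0V N) (lookup is j)                              ≡⟨ lookup-replicate (lookup is j) 0F ⟩
      0F                                                       ≡⟨ sym (lookup-replicate j 0F) ⟩
      lookup (0V s) j                                          ∎

  module _ {n r} (b : Bilinear n r) where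

    β-0ʳ : ∀ x → β b x (0V n) ≡ 0V r
    β-0ʳ x = trans (cong (β b x) (sym (·V-zeroˡ (0V n)))) (trans (scaleʳ b 0F x (0V n)) (·V-zeroˡ _))

    β-0ˡ : ∀ y → β b (0V n) y ≡ 0V r
    β-0ˡ y = trans (cong (λ x → β b x y) (sym (·V-zeroˡ (0V n)))) (trans (scaleˡ b 0F (0V n) y) (·V-zeroˡ _))

    β-negʳ : ∀ x y → β b x (-V y) ≡ -V β b x y
    β-negʳ x y = 𝕍ᴾ.inverseˡ-unique (β b x (-V y)) (β b x y)
      (trans (sym (addʳ b x (-V y) y)) (trans (cong (β b x) (𝕍.inverseˡ y)) (β-0ʳ x)))

    β-lincombʳ : ∀ {m} x (cs : Vect m) (es : Vec (Vect n) m) → β b x (lincomb cs es) ≡ lincomb cs (map (β b x) es)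
    β-lincombʳ x []       []       = β-0ʳ x
    β-lincombʳ x (c ∷ cs) (e ∷ es) = trans (addʳ b x _ _) (cong₂ _+V_ (scaleʳ b c x e) (β-lincombʳ x cs es))

    β-lincombˡ : ∀ {m} y (cs : Vect m) (es : Vec (Vect n) m) →
      β b (lincomb cs es) y ≡ lincomb cs (map (λ e → β b e y) es)
    β-lincombˡ y []       []       = β-0ˡ y
    β-lincombˡ y (c ∷ cs) (e ∷ es) = trans (addˡ b _ _ y) (cong₂ _+V_ (scaleˡ b c e y) (β-lincombˡ y cs es))

    dot-lincombʳ : ∀ {m} (l : Vect r) (cs : Vect m) (ws : Vec (Vect r) m) → dot l (lincomb cs ws) ≡ dot cs (map (dot l) ws)
    dot-lincombʳ l cs ws = trans (dot-comm l _) (trans (dot-lincombˡ cs ws l) (cong (dot cs) (map-cong (λ w → dot-comm w l) ws)))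

    module _ (l : Vect r) where

      ·β-addˡ : ∀ x x' y → (l ·β b) (x +V x') y ≡ (l ·β b) x y +F (l ·β b) x' y
      ·β-addˡ x x' y = trans (cong (dot l) (addˡ b x x' y)) (dot-+ʳ l _ _)

      ·β-lincombˡ : ∀ {m} y (cs : Vect m) (es : Vec (Vect n) m) →
        (l ·β b) (lincomb cs es) y ≡ dot cs (map (λ e → (l ·β b) e y) es)
      ·β-lincombˡ y cs es = trans (cong (dot l) (β-lincombˡ y cs es))
        (trans (dot-lincombʳ l cs _) (cong (dot cs) (sym (map-∘ (dot l) (λ e → β b e y) es))))

      ·β-lincombʳ : ∀ {m} x (cs : Vect m) (es : Vec (Vect n) m) →
        (l ·β b) x (lincomb cs es) ≡ dot cs (map ((l ·β b) x) es)
      ·β-lincombʳ x cs es = trans (cong (dot l) (β-lincombʳ x cs es))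
        (trans (dot-lincombʳ l cs _) (cong (dot cs) (sym (map-∘ (dot l) (β b x) es))))

      gram-dot : ∀ {m} (es : Vec (Vect n) m) c t →
        dot t (lincomb c (gram (l ·β b) es)) ≡ (l ·β b) (lincomb c es) (lincomb t es)
      gram-dot es c t = begin
        dot t (lincomb c (gram (l ·β b) es))          ≡⟨ cong (dot t) (lookup-ext entry) ⟩
        dot t (map ((l ·β b) (lincomb c es)) es)      ≡⟨ sym (·β-lincombʳ (lincomb c es) t es) ⟩
        (l ·β b) (lincomb c es) (lincomb t es)        ∎
        where
        open ≡-Reasoning
        column : ∀ j → map (λ row → lookup row j) (gram (l ·β b) es) ≡ map (λ e → (l ·β b) e (lookup es j)) es
        column j = lookup-ext λ i → begin
          lookup (map (λ row → lookup row j) (gram (l ·β b) es)) i  ≡⟨ lookup-map i (λ row → lookup row j) (gram (l ·β b) es) ⟩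
          lookup (lookup (gram (l ·β b) es) i) j                     ≡⟨ cong (λ row → lookup row j) (lookup∘tabulate _ i) ⟩
          lookup (tabulate (λ j → (l ·β b) (lookup es i) (lookup es j))) j ≡⟨ lookup∘tabulate _ j ⟩
          (l ·β b) (lookup es i) (lookup es j)                       ≡⟨ sym (lookup-map i (λ e → (l ·β b) e (lookup es j)) es) ⟩
          lookup (map (λ e → (l ·β b) e (lookup es j)) es) i         ∎
        entry : ∀ j → lookup (lincomb c (gram (l ·β b) es)) j ≡ lookup (map ((l ·β b) (lincomb c es)) es) j
        entry j = begin
          lookup (lincomb c (gram (l ·β b) es)) j                     ≡⟨ lookup-lincomb c (gram (l ·β b) es) j ⟩
          dot c (map (λ row → lookup row j) (gram (l ·β b) es))      ≡⟨ cong (dot c) (column j) ⟩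
          dot c (map (λ e → (l ·β b) e (lookup es j)) es)            ≡⟨ sym (·β-lincombˡ (lookup es j) c es) ⟩
          (l ·β b) (lincomb c es) (lookup es j)                       ≡⟨ sym (lookup-map j ((l ·β b) (lincomb c es)) es) ⟩
          lookup (map ((l ·β b) (lincomb c es)) es) j                 ∎

      map-·β-addˡ : ∀ {m} x x' (es : Vec (Vect n) m) →
        map ((l ·β b) (x +V x')) es ≡ map ((l ·β b) x) es +V map ((l ·β b) x') es
      map-·β-addˡ x x' []       = refl
      map-·β-addˡ x x' (e ∷ es) = cong₂ _∷_ (·β-addˡ x x' e) (map-·β-addˡ x x' es)

    -- Let G be the Gram matrix of λ·β on e', with s independent rows, and T the e'-coordinates of eS.
    -- If lincomb c eV = lincomb c' e', the condition on c reads T ⊙ (c' G) = const. So c' G is pinned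
    -- down by m' − m further coordinates (T has independent rows), and c' by m' − s more (rank-transpose).
    module Fibre {m M m' s} {eS : Vec (Vect n) m} {eV : Vec (Vect n) M} {e' : Vec (Vect n) m'}
                 (eS-indep : LinIndep eS) (eV-indep : LinIndep eV)
                 (eS-span : ∀ j → InSpan e' (lookup eS j)) (eV-span : ∀ q → InSpan e' (lookup eV q))
                 (l : Vect r) (is : Vec (Fin m') s) (rows-indep : LinIndep (map (lookup (gram (l ·β b) e')) is))
                 (x₀ : Vect n) (ψ : Vect m) where

      f = l ·β b

      Solves : Vect M → Set
      Solves c = map (f (x₀ +V lincomb c eV)) eS ≡ ψ

      Φ-data = rank-transpose (gram f e') is rows-indep
      Φ-rank = independent⇒fullRowRank (proj₁ Φ-data) (proj₁ (proj₂ Φ-data))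

      Q-data = change-of-basis {e' = e'} {es = eV} eV-span

      coords : Vect M → Vect m'
      coords c = lincomb c (proj₁ Q-data)

      T-data = coordinates {es = e'} {ws = eS} eS-span
      T = proj₁ T-data
      T-rank = independent⇒fullRowRank T (coordinates-independent T (proj₂ T-data) eS-indep)

      U : Vect M → Vect m'
      U c = lincomb (coords c) (gram f e')

      T⊙U : ∀ c → T ⊙ U c ≡ map (f (lincomb c eV)) eS
      T⊙U c = begin
        map (λ t → dot t (U c)) T                                     ≡⟨ map-cong (gram-dot l e' (coords c)) T ⟩
        map (λ t → f (lincomb (coords c) e') (lincomb t e')) T         ≡⟨ map-∘ (f (lincomb (coords c) e')) (λ t → lincomb t e') T ⟩
        map (f (lincomb (coords c) e')) (map (λ t → lincomb t e') T)   ≡⟨ cong₂ (λ x es → map (f x) es) (proj₂ Q-data c) (proj₂ T-data) ⟩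
        map (f (lincomb c eV)) eS                                      ∎
        where open ≡-Reasoning

      T⊙U-determined : ∀ {c c'} → Solves c → Solves c' → T ⊙ U c ≡ T ⊙ U c'
      T⊙U-determined {c} {c'} Pc Pc' = 𝕍ᴾ.∙-cancelˡ (map (f x₀) eS) _ _
        (trans (sym (split c)) (trans Pc (sym (trans (sym (split c')) Pc'))))
        where
        split : ∀ c → map (f (x₀ +V lincomb c eV)) eS ≡ map (f x₀) eS +V (T ⊙ U c)
        split c = trans (map-·β-addˡ l x₀ (lincomb c eV) eS) (cong (map (f x₀) eS +V_) (sym (T⊙U c)))

      g : Vect M → Vect ((m' ∸ m) + (m' ∸ s))
      g c = FullRowRank.fibreCoord T-rank (U c) ++ FullRowRank.fibreCoord Φ-rank (coords c)

      g-injective : ∀ {c c'} → Solves c → Solves c' → g c ≡ g c' → c ≡ c'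
      g-injective {c} {c'} Pc Pc' e = lincomb-injective eV-indep (begin
        lincomb c eV             ≡⟨ sym (proj₂ Q-data c) ⟩
        lincomb (coords c) e'    ≡⟨ cong (λ z → lincomb z e') coords≡ ⟩
        lincomb (coords c') e'   ≡⟨ proj₂ Q-data c' ⟩
        lincomb c' eV            ∎)
        where
        open ≡-Reasoning
        pieces = ++-injective (FullRowRank.fibreCoord T-rank (U c)) (FullRowRank.fibreCoord T-rank (U c')) e
        U≡ : U c ≡ U c'
        U≡ = FullRowRank.fibreCoord-injective T-rank (T⊙U-determined {c} {c'} Pc Pc') (proj₁ pieces)
        coords≡ : coords c ≡ coords c'
        coords≡ = FullRowRank.fibreCoord-injective Φ-rank (proj₂ (proj₂ Φ-data) U≡) (proj₂ pieces)

    fibre-bound : ∀ {m d s} {V S : Subspace n} {eS : Vec (Vect n) m} {eV : Vec (Vect n) (m + d)} →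
      S ⊆S V → IsBasis S eS → IsBasis V eV → ∀ l → FormRankOnAtLeast V (l ·β b) s → ∀ x₀ ψ →
      length (L.filter (λ c → map ((l ·β b) (x₀ +V lincomb c eV)) eS ≟V ψ) (allVecs (m + d))) * p ^ s
        ≤ p ^ (m + d + d)
    fibre-bound {m} {d} {s} S⊆V (eS∈S , eS-indep , _) (eV∈V , eV-indep , eV-span)
                l (m' , e' , (e'∈V , e'-indep , e'-span) , is , rows-indep) x₀ ψ = begin
      length (L.filter _ (allVecs (m + d))) * p ^ s  ≤⟨ ℕ.*-monoˡ-≤ (p ^ s) (length-filter-≤-injection _ g g-injective) ⟩
      p ^ ((m' ∸ m) + (m' ∸ s)) * p ^ s              ≡⟨ sym (ℕ.^-distribˡ-+-* p ((m' ∸ m) + (m' ∸ s)) s) ⟩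
      p ^ ((m' ∸ m) + (m' ∸ s) + s)                  ≤⟨ ℕ.^-monoʳ-≤ p (dim-arith {m} {d} {s} {m'} s≤m' m'≤m+d) ⟩
      p ^ (m + d + d)                                ∎
      where
      open ℕ.≤-Reasoning
      open Fibre eS-indep eV-indep (λ j → e'-span _ (S⊆V _ (eS∈S j))) (λ q → e'-span _ (eV∈V q)) l is rows-indep x₀ ψ
      s≤m' = FullRowRank.N≤m Φ-rank
      m'≤m+d = independent-in-span⇒≤ e'-indep (λ i → eV-span _ (e'∈V i))

  -- The linear system attached to a tuple of points

  module LinearSystem {n r m} (b : Bilinear n r) (eS : Vec (Vect n) m) where

    block : Vect n → Vec (Vect m) r
    block x = transpose (map (β b x) eS)

    rows : ∀ {K} → Vec (Vect n) K → Vec (Vect m) (K * r)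
    rows Z = concat (map block Z)

    rows-⊙ : ∀ {K} (Z : Vec (Vect n) K) u → rows Z ⊙ u ≡ concat (map (λ z → β b z (lincomb u eS)) Z)
    rows-⊙ Z u = begin
      map (λ t → dot t u) (concat (map block Z))    ≡⟨ map-concat (λ t → dot t u) (map block Z) ⟩
      concat (map (_⊙ u) (map block Z))              ≡⟨ cong concat (sym (map-∘ (_⊙ u) block Z)) ⟩
      concat (map (λ z → block z ⊙ u) Z)             ≡⟨ cong concat (map-cong (λ z → trans (transpose-⊙ _ u) (sym (β-lincombʳ b z u eS))) Z) ⟩
      concat (map (λ z → β b z (lincomb u eS)) Z)    ∎
      where open ≡-Reasoning

    lincomb-block : ∀ l x → lincomb l (block x) ≡ map ((l ·β b) x) eS
    lincomb-block l x = trans (lincomb-transpose l (map (β b x) eS)) (sym (map-∘ (dot l) (β b x) eS))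

    independent⇒sumIsS : ∀ {V S : Subspace n} {k} → S ⊆S V → IsBasis S eS → (xs ys : Vec (Vect n) k) →
      LinIndep (rows (xs ++ ys)) → SumIsS b V S xs ys
    independent⇒sumIsS {V} {S} {k} S⊆V (eS∈S , _) xs ys indep v = decompose , recompose
      where
      recompose : (∃ λ u → ∃ λ w → InCapB b V S xs u × InCapB b V S ys w × u +V w ≡ v) → mem S v
      recompose (u , w , (u∈S , _) , (w∈S , _) , u+w≡v) = subst (mem S) u+w≡v (add-mem S u∈S w∈S)

      decompose : mem S v → ∃ λ u → ∃ λ w → InCapB b V S xs u × InCapB b V S ys w × u +V w ≡ v
      decompose v∈S = w' , v +V (-V w') , (w'∈S , λ i → S⊆V _ w'∈S , β-xs i) ,
                      (v-w'∈S , λ i → S⊆V _ v-w'∈S , β-ys i) , +V-inverse-cancel w' v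
        where
        open ≡-Reasoning
        sol = FullRowRank.solve (independent⇒fullRowRank (rows (xs ++ ys)) indep)
                (concat (replicate k (0V r) ++ map (λ y → β b y v) ys))
        w' = lincomb (proj₁ sol) eS
        w'∈S = lincomb-mem S eS∈S (proj₁ sol)
        v-w'∈S = add-mem S v∈S (subst (mem S) (lincomb-neg (proj₁ sol) eS) (lincomb-mem S eS∈S (-V proj₁ sol)))
        blocks = ++-injective (map (λ z → β b z w') xs) (replicate k (0V r))
          (trans (sym (map-++ (λ z → β b z w') xs ys)) (concat-injective (trans (sym (rows-⊙ (xs ++ ys) (proj₁ sol))) (proj₂ sol))))
        β-xs : ∀ i → β b (lookup xs i) w' ≡ 0V r
        β-xs i = trans (sym (lookup-map i (λ z → β b z w') xs))
                       (trans (cong (λ zs → lookup zs i) (proj₁ blocks)) (lookup-replicate i (0V r)))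
        β-ys : ∀ i → β b (lookup ys i) (v +V (-V w')) ≡ 0V r
        β-ys i = begin
          β b y (v +V (-V w'))           ≡⟨ addʳ b y v (-V w') ⟩
          β b y v +V β b y (-V w')       ≡⟨ cong (β b y v +V_) (β-negʳ b y w') ⟩
          β b y v +V (-V β b y w')       ≡⟨ cong (λ z → β b y v +V (-V z)) same ⟩
          β b y v +V (-V β b y v)        ≡⟨ 𝕍.inverseʳ _ ⟩
          0V r                           ∎
          where
          y = lookup ys i
          same : β b y w' ≡ β b y v
          same = trans (sym (lookup-map i (λ z → β b z w') ys))
                       (trans (cong (λ zs → lookup zs i) (proj₂ blocks)) (lookup-map i (λ z → β b z v) ys))

  -- Exceptional tuples

  -- A dependency pattern (λ, i): a coefficient vector λⱼ ∈ F_p^r for each of K + 1 points, and a point i.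
  Pattern : ℕ → ℕ → Set
  Pattern r K = Vec (Vect r) (suc K) × Fin (suc K)

  pivotCoeff : ∀ {r K} → Pattern r K → Vect r
  pivotCoeff (ls , i) = lookup ls i

  NonzeroAt : ∀ {r K} → Pattern r K → Set
  NonzeroAt σ = pivotCoeff σ ≢ 0V _

  nonzeroAt? : ∀ {r K} → Decidable (NonzeroAt {r} {K})
  nonzeroAt? σ = ¬? (pivotCoeff σ ≟V 0V _)

  allPatterns : ∀ r K → List (Pattern r K)
  allPatterns r K = L.cartesianProduct (tuples (allVecs r) (suc K)) (L.allFin (suc K))

  patterns : ∀ r K → List (Pattern r K)
  patterns r K = L.filter nonzeroAt? (allPatterns r K)

  ∈-patterns⁻ : ∀ {r K} {σ : Pattern r K} → σ ∈ patterns r K → NonzeroAt σ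
  ∈-patterns⁻ {r} {K} σ∈ = proj₂ (∈-filter⁻ nonzeroAt? {xs = allPatterns r K} σ∈)

  length-patterns : ∀ r K → length (patterns r K) ≤ p ^ (suc K * r) * p ^ (suc K * r)
  length-patterns zero K = ℕ.≤-trans (ℕ.≤-reflexive (cong length no-patterns)) z≤n
    where
    Vect0-unique : (v : Vect 0) → v ≡ []
    Vect0-unique [] = refl
    no-patterns : patterns 0 K ≡ L.[]
    no-patterns = filter-none nonzeroAt? {xs = allPatterns 0 K} (All.tabulate (λ _ nonzero → nonzero (Vect0-unique _)))
  length-patterns r@(suc _) K = begin
    length (patterns r K)                                            ≤⟨ length-filter nonzeroAt? (allPatterns r K) ⟩
    length (allPatterns r K)                                         ≡⟨ length-cartesianProductWith _,_ (tuples (allVecs r) (suc K)) _ ⟩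
    length (tuples (allVecs r) (suc K)) * length (L.allFin (suc K))  ≡⟨ cong₂ _*_ length-coefficients (length-tabulate (λ i → i)) ⟩
    (p ^ r) ^ suc K * suc K
      ≡⟨ cong (_* suc K) (trans (ℕ.^-*-assoc p r (suc K)) (cong (p ^_) (ℕ.*-comm r (suc K)))) ⟩
    p ^ (suc K * r) * suc K                                          ≤⟨ ℕ.*-monoʳ-≤ (p ^ (suc K * r)) K+1≤ ⟩
    p ^ (suc K * r) * p ^ (suc K * r)                                ∎
    where
    open ℕ.≤-Reasoning
    length-coefficients : length (tuples (allVecs r) (suc K)) ≡ (p ^ r) ^ suc K
    length-coefficients = trans (length-tuples (allVecs r) (suc K)) (cong (_^ suc K) (length-allVecs r))
    K+1≤ : suc K ≤ p ^ (suc K * r)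
    K+1≤ = ℕ.≤-trans (n≤2^n (suc K)) (ℕ.≤-trans (ℕ.^-monoˡ-≤ (suc K) (nonTrivial⇒n>1 p {{prime⇒nonTrivial pr}}))
             (ℕ.^-monoʳ-≤ p (ℕ.m≤m*n (suc K) r)))

  module DependentTuples {n r m d} (b : Bilinear n r) (eS : Vec (Vect n) m) (eV : Vec (Vect n) (m + d))
                         (a : Vect n) (K : ℕ) where
    open LinearSystem b eS

    enc : Vect (m + d) → Vect n
    enc c = a +V lincomb c eV

    points : List (Vect n)
    points = L.map enc (allVecs (m + d))

    residual : Pattern r K → Vec (Vect n) K → Vect m
    residual (ls , i) Z' = lincomb (concat (removeAt ls i)) (rows Z')

    completions : Pattern r K → Vec (Vect n) K → List (Vect (m + d))
    completions σ Z' = L.filter (λ c → map ((pivotCoeff σ ·β b) (enc c)) eS ≟V (-V residual σ Z'))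
                                (allVecs (m + d))

    -- If Σⱼ λⱼ·β(zⱼ, ·) vanishes on S with λᵢ ≠ 0, then zᵢ solves an affine system determined by (λ, i) and the
    -- other points Z'. Listing the solutions for every (λ, i) and Z' covers all tuples with dependent rows.
    dependentTuples : List (Vec (Vect n) (suc K))
    dependentTuples = L.concatMap (λ σ → L.concatMap (λ Z' → L.map (λ c → insertAt Z' (proj₂ σ) (enc c)) (completions σ Z'))
                                                     (tuples points K))
                                  (patterns r K)

    length-dependentTuples : ∀ {s} {V S : Subspace n} → S ⊆S V → IsBasis S eS → IsBasis V eV →
      (∀ l → l ≢ 0V r → FormRankOnAtLeast V (l ·β b) s) →
      length dependentTuples * p ^ s ≤ length (patterns r K) * ((p ^ (m + d)) ^ K * p ^ (m + d + d))
    length-dependentTuples {s} {V} {S} S⊆V bS bV rank =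
      subst (λ N → length dependentTuples * p ^ s ≤ length (patterns r K) * (N * p ^ (m + d + d))) length-tuples-points
        (length-concatMap-≤ _ (patterns r K) λ {σ} σ∈ → length-concatMap-≤ _ (tuples points K) λ {Z'} _ →
          ℕ.≤-trans (ℕ.≤-reflexive (cong (_* p ^ s) (length-map (λ c → insertAt Z' (proj₂ σ) (enc c)) (completions σ Z'))))
            (fibre-bound b {d = d} {V = V} {S = S} S⊆V bS bV (pivotCoeff σ) (rank (pivotCoeff σ) (∈-patterns⁻ {r} {K} σ∈))
              a (-V residual σ Z')))
      where
      length-tuples-points : length (tuples points K) ≡ (p ^ (m + d)) ^ K
      length-tuples-points = trans (length-tuples points K)
        (cong (_^ K) (trans (length-map enc (allVecs (m + d))) (length-allVecs (m + d))))

    residual-isolates : ∀ (ls : Vec (Vect r) (suc K)) i Z' z →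
      lincomb (concat ls) (rows (insertAt Z' i z)) ≡ map ((lookup ls i ·β b) z) eS +V residual (ls , i) Z'
    residual-isolates ls i Z' z = begin
      lincomb (concat ls) (rows (insertAt Z' i z))                    ≡⟨ cong (λ Ws → lincomb (concat ls) (concat Ws)) (map-insertAt block z Z' i) ⟩
      lincomb (concat ls) (concat (insertAt (map block Z') i (block z))) ≡⟨ lincomb-concat-insertAt ls (map block Z') i (block z) ⟩
      lincomb (lookup ls i) (block z) +V residual (ls , i) Z'         ≡⟨ cong (_+V residual (ls , i) Z') (lincomb-block (lookup ls i) z) ⟩
      map ((lookup ls i ·β b) z) eS +V residual (ls , i) Z'           ∎
      where open ≡-Reasoning

    module _ {V : Subspace n} (bV : IsBasis V eV) where

      coset-coordinates : ∀ {x} → InCoset a V x → Σ (Vect (m + d)) λ c → enc c ≡ x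
      coset-coordinates {x} x∈ = proj₁ coords , trans (cong (a +V_) (proj₂ coords)) (+V-inverse-cancel a x)
        where coords = proj₂ (proj₂ bV) _ x∈

      ∈-points : ∀ {x} → InCoset a V x → x ∈ points
      ∈-points x∈ = subst (_∈ points) (proj₂ (coset-coordinates x∈)) (∈-map⁺ enc (∈-allVecs (proj₁ (coset-coordinates x∈))))

      ∈-dependentTuples : (Z : Vec (Vect n) (suc K)) → (∀ i → InCoset a V (lookup Z i)) →
        ∀ cs → cs ≢ 0V (suc K * r) → lincomb cs (rows Z) ≡ 0V m → Z ∈ dependentTuples
      ∈-dependentTuples Z Z∈ cs cs≢0 dependent =
        ∈-concatMap⁺ _ (Any.map (λ { refl → ∈-concatMap⁺ _ (Any.map (λ { refl → Z∈completed }) Z'∈) }) σ∈)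
        where
        ls = proj₁ (group (suc K) r cs)
        cs≡ : cs ≡ concat ls
        cs≡ = proj₂ (group (suc K) r cs)
        nonzero = ∃-lookup-≢ _≟V_ (0V r) ls (λ ls≡0 → cs≢0 (trans cs≡ (trans (cong concat ls≡0) (concat-0V (suc K)))))
        i = proj₁ nonzero
        σ : Pattern r K
        σ = ls , i
        σ∈ : σ ∈ patterns r K
        σ∈ = ∈-filter⁺ nonzeroAt? (∈-cartesianProduct⁺ (∈-tuples ls (λ j → ∈-allVecs (lookup ls j))) (∈-allFin i)) (proj₂ nonzero)
        Z' = removeAt Z i
        Z'∈ : Z' ∈ tuples points K
        Z'∈ = ∈-tuples Z' (λ j → ∈-points (subst (InCoset a V) (sym (lookup-removeAt Z i j)) (Z∈ (Fin.punchIn i j))))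
        c = proj₁ (coset-coordinates (Z∈ i))
        Z≡ : insertAt Z' i (enc c) ≡ Z
        Z≡ = trans (cong (insertAt Z' i) (proj₂ (coset-coordinates (Z∈ i)))) (insertAt-removeAt Z i)
        completes : map ((lookup ls i ·β b) (enc c)) eS ≡ -V residual σ Z'
        completes = 𝕍ᴾ.inverseˡ-unique _ _ (trans (sym (residual-isolates ls i Z' (enc c)))
          (trans (cong (λ Y → lincomb (concat ls) (rows Y)) Z≡) (trans (cong (λ u → lincomb u (rows Z)) (sym cs≡)) dependent)))
        Z∈completed : Z ∈ L.map (λ c → insertAt Z' i (enc c)) (completions σ Z')
        Z∈completed = subst (_∈ L.map (λ c → insertAt Z' i (enc c)) (completions σ Z')) Z≡
          (∈-map⁺ (λ c → insertAt Z' i (enc c)) (∈-filter⁺ _ (∈-allVecs c) completes))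

      ∉-dependentTuples⇒independent : (Z : Vec (Vect n) (suc K)) → (∀ i → InCoset a V (lookup Z i)) →
        Z ∉ dependentTuples → LinIndep (rows Z)
      ∉-dependentTuples⇒independent Z Z∈ Z∉ cs dependent with cs ≟V 0V _
      ... | yes cs≡0 = cs≡0
      ... | no cs≢0  = ⊥-elim (Z∉ (∈-dependentTuples Z Z∈ cs cs≢0 dependent))

lemma2p8 : (p : ℕ) (pr : Prime p) (n r s d k : ℕ) → 1 ≤ k →
    (b : Fp.Bilinear p pr n r) (V : Fp.Subspace p pr n) →
    (∀ (l : Fp.Vect p pr r) → l ≢ Fp.0V p pr r →
      Fp.FormRankOnAtLeast p pr V (Fp._·β_ p pr l b) s) →
    (a : Fp.Vect p pr n) (S : Fp.Subspace p pr n) →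
    Fp._⊆S_ p pr S V → Fp.Codim p pr S V d →
    Σ (List (Vec (Fp.Vect p pr n) k × Vec (Fp.Vect p pr n) k)) λ E →
      (length E ^ 4 * p ^ s ≤ 81 ^ 4 * p ^ (8 * d + 16 * k * r) * Fp.card p pr V ^ (8 * k))
      × (∀ (xs ys : Vec (Fp.Vect p pr n) k) →
           (∀ i → Fp.InCoset p pr a V (lookup xs i)) →
           (∀ i → Fp.InCoset p pr a V (lookup ys i)) →
           (xs , ys) ∉ E →
           Fp.SumIsS p pr b V S xs ys)
lemma2p8 p pr n r s d zero () b V rank a S S⊆V codim
lemma2p8 p pr n r s d (suc k₀) _ b V rank a S S⊆V (m , (eS , bS) , (eV , bV)) =
  exceptional , count-bound , splits
  where
  open DependentTuples p pr b eS eV a (k₀ + suc k₀)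
  instance
    p≢0 : NonZero p
    p≢0 = prime⇒nonZero pr

  exceptional : List (Vec (Fp.Vect p pr n) (suc k₀) × Vec (Fp.Vect p pr n) (suc k₀))
  exceptional = L.map (halves (suc k₀)) dependentTuples

  count-bound : length exceptional ^ 4 * p ^ s ≤ 81 ^ 4 * p ^ (8 * d + 16 * suc k₀ * r) * Fp.card p pr V ^ (8 * suc k₀)
  count-bound = subst (λ X → X ^ 4 * p ^ s ≤ 81 ^ 4 * p ^ (8 * d + 16 * suc k₀ * r) * Fp.card p pr V ^ (8 * suc k₀))
    (sym (length-map (halves (suc k₀)) dependentTuples))
    (exceptional-count-arith p (81 ^ 4) {{ℕ.m^n≢0 81 4}} {length dependentTuples} {s} {d} {r} {m + d} {Fp.card p pr V} k₀
      (p^dim≤card p pr {V = V} bV)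
      (ℕ.≤-trans (length-dependentTuples {V = V} {S = S} S⊆V bS bV rank) (ℕ.*-monoˡ-≤ _ (length-patterns p pr r _))))

  splits : ∀ xs ys → (∀ i → Fp.InCoset p pr a V (lookup xs i)) → (∀ i → Fp.InCoset p pr a V (lookup ys i)) →
    (xs , ys) ∉ exceptional → Fp.SumIsS p pr b V S xs ys
  splits xs ys xs∈ ys∈ xs,ys∉ = LinearSystem.independent⇒sumIsS p pr b eS {V = V} {S = S} S⊆V bS xs ys
    (∉-dependentTuples⇒independent {V = V} bV (xs ++ ys) (lookup-++⁺ {P = Fp.InCoset p pr a V} xs ys xs∈ ys∈)
      (λ Z∈ → xs,ys∉ (subst (_∈ exceptional) (halves-++ xs ys) (∈-map⁺ (halves (suc k₀)) Z∈))))
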